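{- Let $f$ be an endomorphism of $\Omega$, $\mathcal U$ an ultrafilter on $\Omega$, $A,B$ formulas of MRLJ, and $R\subseteq\Omega$ a role set with $R\in\mathcal J$, $R\notin\mathcal U$ and $f^{ -1}(R)=\overline R$. If $\vdash R\{A\supset_{f,\mathcal U}B\}$ is derivable in MRLJ, then $R\{A\}\Rightarrow R\{B\}$, i.e., for every sequent $\Gamma$, if $\vdash\Gamma,R\{A\}$ is derivable in MRLJ then $\vdash\Gamma,R\{B\}$ is derivable in MRLJ.
   Context: Fix a set $\Omega$ of roles (possibly infinite). A role set is a subset $R\subseteq\Omega$; $\overline{R}=\Omega\setminus R$; $R_1\uplus\cdots\uplus R_n=\Omega$ means the $R_i$ are pairwise disjoint with union $\Omega$. An ultrafilter on $\Omega$ is a family $\mathcal U$ of subsets of $\Omega$ with $\Omega\in\mathcal U$, closed upward and under binary intersection, and containing $R$ or $\overline R$ for every $R$. For an endomorphism $f$ of $\Omega$, $f^{ -1}(R)=\{r\mid f(r)\in R\}$. Formulas of MRLJ, over first-order terms $t$ and variables $x$: $A,B::=a\mid\neg_f(A)\mid A\wedge_{\mathcal U}B\mid A\supset_{f,\mathcal U}B\mid\forall_{\mathcal U}(\lambda x.A)$. An i-formula is $R\{A\}$; a sequent is a finite multiset of i-formulas. MRLJ is parameterized by a fixed ultrafilter $\mathcal J$ on $\Omega$; a sequent is $\mathcal J$-intuitionistic if it contains at most one i-formula $R\{A\}$ with $R\in\mathcal J$, and a rule instance is $\mathcal J$-intuitionistic if its conclusion and all premisses are. The rules of MRLJ are all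 $\mathcal J$-intuitionistic instances of: (Id) $\vdash R_1\{a\},\ldots,R_n\{a\}$ whenever $R_1\uplus\cdots\uplus R_n=\Omega$; (Weaken) from $\Gamma$ infer $\Gamma,R\{A\}$; (Contract) from $\Gamma,R\{A\},R\{A\}$ infer $\Gamma,R\{A\}$; ($\neg$) from $\Gamma,f^{ -1}(R)\{A\}$ infer $\Gamma,R\{\neg_f(A)\}$; ($\wedge$-neg-l/r) if $R\notin\mathcal U$, from $\Gamma,R\{A\}$ (resp. $\Gamma,R\{B\}$) infer $\Gamma,R\{A\wedge_{\mathcal U}B\}$; ($\wedge$-pos) if $R\in\mathcal U$, from $\Gamma,R\{A\}$ and $\Gamma,R\{B\}$ infer $\Gamma,R\{A\wedge_{\mathcal U}B\}$; ($\forall$-neg) if $R\notin\mathcal U$, from $\Gamma,R\{A[x:=t]\}$ infer $\Gamma,R\{\forall_{\mathcal U}(\lambda x.A)\}$; ($\forall$-pos) if $R\in\mathcal U$ and $x$ not free in $\Gamma$, from $\Gamma,R\{A\}$ infer $\Gamma,R\{\forall_{\mathcal U}(\lambda x.A)\}$; plus ($\supset$-neg) if $R\notin\mathcal U$, from $\Gamma,f^{ -1}(R)\{A\},R\{B\}$ infer $\Gamma,R\{A\supset_{f,\mathcal U}B\}$; ($\supset$-pos) if $R\in\mathcal U$, from $\Gamma_1,f^{ -1}(R)\{A\}$ and $\Gamma_2,R\{B\}$ infer $\Gamma_1,\Gamma_2,R\{A\supset_{f,\mathcal U}B\}$. -}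

module Defs where

open import Level using (Level) renaming (suc to lsuc; zero to lzero)
open import Data.Nat using (ℕ; zero; suc)
open import Data.Fin using (Fin)
open import Data.List using (List; []; _∷_; _++_; map; length; lookup)
open import Data.List.Relation.Unary.All using (All)
open import Data.List.Relation.Binary.Pointwise using (Pointwise)
open import Data.List.Relation.Binary.Permutation.Propositional using (_↭_)
open import Data.Product using (Σ; _×_; _,_; ∃)
open import Data.Sum using (_⊎_)
open import Data.Unit using (⊤)
open import Relation.Nullary using (¬_)
open import Relation.Binary.PropositionalEquality using (_≡_)

RoleSet : Set → Set₁
RoleSet Ω = Ω → Set

∁ : {Ω : Set} → RoleSet Ω → RoleSet Ω
∁ R r = ¬ R r

Full : {Ω : Set} → RoleSet Ω
Full _ = ⊤

preimage : {Ω : Set} → (Ω → Ω) → RoleSet Ω → RoleSet Ω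
preimage f R r = R (f r)

_⊆_ : {Ω : Set} → RoleSet Ω → RoleSet Ω → Set
R ⊆ S = ∀ r → R r → S r

_≐_ : {Ω : Set} → RoleSet Ω → RoleSet Ω → Set
R ≐ S = R ⊆ S × S ⊆ R

IsPartition : {Ω : Set} → List (RoleSet Ω) → Set
IsPartition {Ω} Rs =
  (∀ (r : Ω) → ∃ λ (i : Fin (length Rs)) → lookup Rs i r)
  × (∀ (r : Ω) (i j : Fin (length Rs)) → lookup Rs i r → lookup Rs j r → i ≡ j)

record Ultrafilter (Ω : Set) : Set₁ where
  field
    _∈U : RoleSet Ω → Set
    full∈ : Full ∈U
    upward : ∀ {R S} → R ∈U → R ⊆ S → S ∈U
    inter : ∀ {R S} → R ∈U → S ∈U → (λ r → R r × S r) ∈U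
    total : ∀ R → R ∈U ⊎ ∁ R ∈U

_∈_ : {Ω : Set} → RoleSet Ω → Ultrafilter Ω → Set
R ∈ 𝒰 = Ultrafilter._∈U 𝒰 R

_∉_ : {Ω : Set} → RoleSet Ω → Ultrafilter Ω → Set
R ∉ 𝒰 = ¬ (R ∈ 𝒰)

_≈U_ : {Ω : Set} → Ultrafilter Ω → Ultrafilter Ω → Set₁
𝒰 ≈U 𝒱 = ∀ R → (R ∈ 𝒰 → R ∈ 𝒱) × (R ∈ 𝒱 → R ∈ 𝒰)

-- First-order terms over function symbols Fun, with variables as
-- de Bruijn indices (so that binding under ∀ is capture-free).

data Term (Fun : Set) : Set where
  var : ℕ → Term Fun
  fn  : Fun → List (Term Fun) → Term Fun

module _ {Fun : Set} where
  mutual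
    renT : (ℕ → ℕ) → Term Fun → Term Fun
    renT ρ (var i) = var (ρ i)
    renT ρ (fn g ts) = fn g (renTs ρ ts)

    renTs : (ℕ → ℕ) → List (Term Fun) → List (Term Fun)
    renTs ρ [] = []
    renTs ρ (t ∷ ts) = renT ρ t ∷ renTs ρ ts

  mutual
    subT : (ℕ → Term Fun) → Term Fun → Term Fun
    subT σ (var i) = σ i
    subT σ (fn g ts) = fn g (subTs σ ts)

    subTs : (ℕ → Term Fun) → List (Term Fun) → List (Term Fun)
    subTs σ [] = []
    subTs σ (t ∷ ts) = subT σ t ∷ subTs σ ts

  liftR : (ℕ → ℕ) → ℕ → ℕ
  liftR ρ zero = zero
  liftR ρ (suc i) = suc (ρ i)

  liftS : (ℕ → Term Fun) → ℕ → Term Fun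
  liftS σ zero = var zero
  liftS σ (suc i) = renT suc (σ i)

module MRLJ (Ω : Set) (Fun Pred : Set) where

  data Formula : Set₁ where
    atom : Pred → List (Term Fun) → Formula
    ¬[_]_ : (Ω → Ω) → Formula → Formula
    _∧[_]_ : Formula → Ultrafilter Ω → Formula → Formula
    _⊃[_,_]_ : Formula → (Ω → Ω) → Ultrafilter Ω → Formula → Formula
    ∀[_] : Ultrafilter Ω → Formula → Formula                   -- ∀_𝒰(λx.A), body uses index 0

  renF : (ℕ → ℕ) → Formula → Formula
  renF ρ (atom p ts) = atom p (renTs ρ ts)
  renF ρ (¬[ f ] A) = ¬[ f ] (renF ρ A)
  renF ρ (A ∧[ 𝒰 ] B) = (renF ρ A) ∧[ 𝒰 ] (renF ρ B)
  renF ρ (A ⊃[ f , 𝒰 ] B) = (renF ρ A) ⊃[ f , 𝒰 ] (renF ρ B)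
  renF ρ (∀[ 𝒰 ] A) = ∀[ 𝒰 ] (renF (liftR {Fun} ρ) A)

  subF : (ℕ → Term Fun) → Formula → Formula
  subF σ (atom p ts) = atom p (subTs σ ts)
  subF σ (¬[ f ] A) = ¬[ f ] (subF σ A)
  subF σ (A ∧[ 𝒰 ] B) = (subF σ A) ∧[ 𝒰 ] (subF σ B)
  subF σ (A ⊃[ f , 𝒰 ] B) = (subF σ A) ⊃[ f , 𝒰 ] (subF σ B)
  subF σ (∀[ 𝒰 ] A) = ∀[ 𝒰 ] (subF (liftS σ) A)

  inst : Term Fun → ℕ → Term Fun
  inst t zero = t
  inst t (suc i) = var i

  _[_] : Formula → Term Fun → Formula
  A [ t ] = subF (inst t) A

  _≈F_ : Formula → Formula → Set₁
  atom p ts ≈F atom q us = Level.Lift (lsuc lzero) ((p ≡ q) × (ts ≡ us))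
  (¬[ f ] A) ≈F (¬[ g ] B) = Level.Lift (lsuc lzero) (∀ r → f r ≡ g r) × A ≈F B
  (A ∧[ 𝒰 ] B) ≈F (C ∧[ 𝒱 ] D) = A ≈F C × 𝒰 ≈U 𝒱 × B ≈F D
  (A ⊃[ f , 𝒰 ] B) ≈F (C ⊃[ g , 𝒱 ] D) =
    A ≈F C × Level.Lift (lsuc lzero) (∀ r → f r ≡ g r) × 𝒰 ≈U 𝒱 × B ≈F D
  (∀[ 𝒰 ] A) ≈F (∀[ 𝒱 ] B) = 𝒰 ≈U 𝒱 × A ≈F B
  _ ≈F _ = Level.Lift (lsuc lzero) (Data.Empty.⊥)
    where import Data.Empty

  record IFormula : Set₁ where
    constructor _⟪_⟫
    field
      role : RoleSet Ω
      form : Formula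
  open IFormula public

  _≈I_ : IFormula → IFormula → Set₁
  (R ⟪ A ⟫) ≈I (S ⟪ B ⟫) = Level.Lift (lsuc lzero) (R ≐ S) × A ≈F B

  -- sequents: finite multisets of i-formulas, represented by lists taken
  -- up to permutation (rule 'exch' below) and up to extensional equality
  -- of the role sets / formulas (rule 'ext' below).
  Sequent : Set₁
  Sequent = List IFormula

  renI : (ℕ → ℕ) → IFormula → IFormula
  renI ρ (R ⟪ A ⟫) = R ⟪ renF ρ A ⟫

  -- Γ with all free variables shifted up by one: used for the
  -- eigenvariable condition of ∀-pos ("x not free in Γ").
  shiftΓ : Sequent → Sequent
  shiftΓ = map (renI suc)

  module _ (𝒥 : Ultrafilter Ω) where

    Intuitionistic : Sequent → Set₁
    Intuitionistic [] = Level.Lift (lsuc lzero) ⊤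
    Intuitionistic (X ∷ Γ) =
      (role X ∈ 𝒥 → All (λ Y → role Y ∉ 𝒥) Γ) × Intuitionistic Γ

    -- Every rule instance is
    -- required to be 𝒥-intuitionistic: each constructor demands it of its
    -- conclusion, and each premiss is the conclusion of a sub-derivation.
    data ⊢_ : Sequent → Set₁ where
      exch : ∀ {Γ Δ} → Γ ↭ Δ → ⊢ Γ → ⊢ Δ
      ext : ∀ {Γ Δ} → Pointwise _≈I_ Γ Δ → ⊢ Γ → ⊢ Δ
      Id : ∀ (p : Pred) (ts : List (Term Fun)) (Rs : List (RoleSet Ω)) →
        IsPartition Rs →
        Intuitionistic (map (λ R → R ⟪ atom p ts ⟫) Rs) →
        ⊢ map (λ R → R ⟪ atom p ts ⟫) Rs
      Weaken : ∀ {Γ} R A → Intuitionistic (R ⟪ A ⟫ ∷ Γ) →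
        ⊢ Γ → ⊢ (R ⟪ A ⟫ ∷ Γ)
      Contract : ∀ {Γ} R A → Intuitionistic (R ⟪ A ⟫ ∷ Γ) →
        ⊢ (R ⟪ A ⟫ ∷ R ⟪ A ⟫ ∷ Γ) → ⊢ (R ⟪ A ⟫ ∷ Γ)
      Neg : ∀ {Γ} R f A → Intuitionistic (R ⟪ ¬[ f ] A ⟫ ∷ Γ) →
        ⊢ (preimage f R ⟪ A ⟫ ∷ Γ) → ⊢ (R ⟪ ¬[ f ] A ⟫ ∷ Γ)
      ∧-neg-l : ∀ {Γ} R 𝒰 A B → R ∉ 𝒰 →
        Intuitionistic (R ⟪ A ∧[ 𝒰 ] B ⟫ ∷ Γ) →
        ⊢ (R ⟪ A ⟫ ∷ Γ) → ⊢ (R ⟪ A ∧[ 𝒰 ] B ⟫ ∷ Γ)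
      ∧-neg-r : ∀ {Γ} R 𝒰 A B → R ∉ 𝒰 →
        Intuitionistic (R ⟪ A ∧[ 𝒰 ] B ⟫ ∷ Γ) →
        ⊢ (R ⟪ B ⟫ ∷ Γ) → ⊢ (R ⟪ A ∧[ 𝒰 ] B ⟫ ∷ Γ)
      ∧-pos : ∀ {Γ} R 𝒰 A B → R ∈ 𝒰 →
        Intuitionistic (R ⟪ A ∧[ 𝒰 ] B ⟫ ∷ Γ) →
        ⊢ (R ⟪ A ⟫ ∷ Γ) → ⊢ (R ⟪ B ⟫ ∷ Γ) → ⊢ (R ⟪ A ∧[ 𝒰 ] B ⟫ ∷ Γ)
      ∀-neg : ∀ {Γ} R 𝒰 A (t : Term Fun) → R ∉ 𝒰 →
        Intuitionistic (R ⟪ ∀[ 𝒰 ] A ⟫ ∷ Γ) →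
        ⊢ (R ⟪ A [ t ] ⟫ ∷ Γ) → ⊢ (R ⟪ ∀[ 𝒰 ] A ⟫ ∷ Γ)
      ∀-pos : ∀ {Γ} R 𝒰 A → R ∈ 𝒰 →
        Intuitionistic (R ⟪ ∀[ 𝒰 ] A ⟫ ∷ Γ) →
        ⊢ (R ⟪ A ⟫ ∷ shiftΓ Γ) → ⊢ (R ⟪ ∀[ 𝒰 ] A ⟫ ∷ Γ)
      ⊃-neg : ∀ {Γ} R f 𝒰 A B → R ∉ 𝒰 →
        Intuitionistic (R ⟪ A ⊃[ f , 𝒰 ] B ⟫ ∷ Γ) →
        ⊢ (preimage f R ⟪ A ⟫ ∷ R ⟪ B ⟫ ∷ Γ) →
        ⊢ (R ⟪ A ⊃[ f , 𝒰 ] B ⟫ ∷ Γ)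
      ⊃-pos : ∀ {Γ₁ Γ₂} R f 𝒰 A B → R ∈ 𝒰 →
        Intuitionistic (R ⟪ A ⊃[ f , 𝒰 ] B ⟫ ∷ (Γ₁ ++ Γ₂)) →
        ⊢ (preimage f R ⟪ A ⟫ ∷ Γ₁) → ⊢ (R ⟪ B ⟫ ∷ Γ₂) →
        ⊢ (R ⟪ A ⊃[ f , 𝒰 ] B ⟫ ∷ (Γ₁ ++ Γ₂))

module Submission where

-- A derivation of R{A ⊃ B} alone, with R ∈ 𝒥 and R ∉ 𝒰, can only end (up to exchange and
-- equivalence) in ⊃-neg, so f⁻¹(R){A}, R{B} is derivable.  Since f⁻¹(R) = R̄ is complementary
-- to R, cutting it against R{A}, Γ on the formula A yields R{B}, Γ.
--
-- Cut between complementary role sets is admissible by Gentzen's argument: induction on the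
-- shape of the cut formula, then on the derivation whose role lies in 𝒥 (one of two
-- complementary role sets does, 𝒥 being an ultrafilter), then on the other derivation, where
-- all copies of the cut formula are removed at once.  The 𝒥-side is 𝒥-intuitionistic with the
-- cut formula as its only 𝒥-formula, so it is never contracted and needs no multicut; atomic
-- cuts glue the partitions of the two axioms.

open import Defs
open import Level using (Lift; lift; lower) renaming (suc to lsuc; zero to lzero)
open import Data.Nat using (ℕ; zero; suc)
open import Data.Fin using (zero; suc)
open import Data.Fin.Properties using (0≢1+n; suc-injective)
open import Data.List using (List; []; _∷_; _++_; map; lookup)
import Data.List.Properties as List
open import Data.List.Relation.Unary.All as All using (All; []; _∷_)
import Data.List.Relation.Unary.All.Properties as All
open import Data.List.Relation.Unary.Any using (Any; here; there)
import Data.List.Relation.Unary.Any.Properties as Any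
open import Data.List.Relation.Binary.Pointwise as Pointwise using (Pointwise; []; _∷_)
open import Data.List.Membership.Propositional using () renaming (_∈_ to _∈ₗ_)
open import Data.List.Membership.Propositional.Properties using (∈-++⁻; ∈-∃++)
open import Data.List.Relation.Binary.Permutation.Propositional as ↭
  using (_↭_; ↭-sym; ↭-trans; ↭-refl; ↭-reflexive; prep; swap)
import Data.List.Relation.Binary.Permutation.Propositional.Properties as ↭
open import Data.Product using (_×_; _,_; proj₁; proj₂; ∃)
open import Data.Sum using (_⊎_; inj₁; inj₂; [_,_]′)
open import Data.Empty using (⊥; ⊥-elim)
open import Data.Unit using (⊤; tt)
open import Function using (_∘_)
open import Relation.Nullary using (¬_)
open import Relation.Binary.PropositionalEquality as ≡
  using (_≡_; refl; sym; cong; cong₂; subst)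
import Algebra.Solver.CommutativeMonoid as CommutativeMonoidSolver

module _ {Ω : Set} where

  ≐-refl : {R : RoleSet Ω} → R ≐ R
  ≐-refl = (λ r x → x) , (λ r x → x)

  ≐-sym : {R S : RoleSet Ω} → R ≐ S → S ≐ R
  ≐-sym (R⊆S , S⊆R) = S⊆R , R⊆S

  ≐-trans : {R S T : RoleSet Ω} → R ≐ S → S ≐ T → R ≐ T
  ≐-trans (R⊆S , S⊆R) (S⊆T , T⊆S) =
    (λ r x → S⊆T r (R⊆S r x)) , (λ r x → S⊆R r (T⊆S r x))

  preimage-cong : {f g : Ω → Ω} {R S : RoleSet Ω} → (∀ r → f r ≡ g r) → R ≐ S →
                  preimage f R ≐ preimage g S
  preimage-cong {f} {g} {R} {S} f≗g (R⊆S , S⊆R) =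
    (λ r x → subst S (f≗g r) (R⊆S (f r) x)) , (λ r x → S⊆R (f r) (subst S (sym (f≗g r)) x))

  ∈-resp-≐ : (𝒰 : Ultrafilter Ω) {R S : RoleSet Ω} → R ≐ S → R ∈ 𝒰 → S ∈ 𝒰
  ∈-resp-≐ 𝒰 (R⊆S , _) R∈𝒰 = Ultrafilter.upward 𝒰 R∈𝒰 R⊆S

  -- A record, unlike the Π-type 𝒰 ≈U 𝒱, lets Agda infer 𝒰 and 𝒱 from a proof.
  record _≈ᵤ_ (𝒰 𝒱 : Ultrafilter Ω) : Set₁ where
    constructor mk≈ᵤ
    field same-members : 𝒰 ≈U 𝒱
  open _≈ᵤ_ public

  ≈ᵤ-refl : {𝒰 : Ultrafilter Ω} → 𝒰 ≈ᵤ 𝒰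
  ≈ᵤ-refl = mk≈ᵤ (λ R → (λ x → x) , (λ x → x))

  ≈ᵤ-sym : {𝒰 𝒱 : Ultrafilter Ω} → 𝒰 ≈ᵤ 𝒱 → 𝒱 ≈ᵤ 𝒰
  ≈ᵤ-sym (mk≈ᵤ e) = mk≈ᵤ (λ R → proj₂ (e R) , proj₁ (e R))

  ≈ᵤ-trans : {𝒰 𝒱 𝒲 : Ultrafilter Ω} → 𝒰 ≈ᵤ 𝒱 → 𝒱 ≈ᵤ 𝒲 → 𝒰 ≈ᵤ 𝒲
  ≈ᵤ-trans (mk≈ᵤ e) (mk≈ᵤ e′) =
    mk≈ᵤ (λ R → (λ x → proj₁ (e′ R) (proj₁ (e R) x)) , (λ x → proj₂ (e R) (proj₂ (e′ R) x)))

  ∈-resp-≈ᵤ : {𝒰 𝒱 : Ultrafilter Ω} {R S : RoleSet Ω} → 𝒰 ≈ᵤ 𝒱 → R ≐ S → R ∈ 𝒰 → S ∈ 𝒱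
  ∈-resp-≈ᵤ {𝒰} (mk≈ᵤ e) R≐S R∈𝒰 = proj₁ (e _) (∈-resp-≐ 𝒰 R≐S R∈𝒰)

  ∉-resp-≈ᵤ : {𝒰 𝒱 : Ultrafilter Ω} {R S : RoleSet Ω} → 𝒰 ≈ᵤ 𝒱 → R ≐ S → R ∉ 𝒰 → S ∉ 𝒱
  ∉-resp-≈ᵤ 𝒰≈𝒱 R≐S R∉𝒰 S∈𝒱 = R∉𝒰 (∈-resp-≈ᵤ (≈ᵤ-sym 𝒰≈𝒱) (≐-sym R≐S) S∈𝒱)

  -- Covering is stated doubly negated, since membership in a role set need not be decidable.
  Complementary : RoleSet Ω → RoleSet Ω → Set
  Complementary S T = (∀ r → S r → T r → ⊥) × (∀ r → ¬ S r → ¬ T r → ⊥)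

  complementary-sym : {S T : RoleSet Ω} → Complementary S T → Complementary T S
  complementary-sym (disjoint , covering) =
    (λ r t s → disjoint r s t) , (λ r ¬t ¬s → covering r ¬s ¬t)

  ∁-complementary : (S : RoleSet Ω) → Complementary S (∁ S)
  ∁-complementary S = (λ r s ¬s → ¬s s) , (λ r ¬s ¬¬s → ¬¬s ¬s)

  complementary-resp-≐ : {S S′ T T′ : RoleSet Ω} → S ≐ S′ → T ≐ T′ →
                         Complementary S T → Complementary S′ T′
  complementary-resp-≐ (S⊆S′ , S′⊆S) (T⊆T′ , T′⊆T) (disjoint , covering) =
    (λ r s t → disjoint r (S′⊆S r s) (T′⊆T r t)) ,
    (λ r ¬s ¬t → covering r (λ s → ¬s (S⊆S′ r s)) (λ t → ¬t (T⊆T′ r t)))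

  preimage-complementary : (f : Ω → Ω) {S T : RoleSet Ω} → Complementary S T →
                           Complementary (preimage f S) (preimage f T)
  preimage-complementary f (disjoint , covering) = (λ r → disjoint (f r)) , (λ r → covering (f r))

  complementary-∈ : (𝒰 : Ultrafilter Ω) {S T : RoleSet Ω} → Complementary S T → S ∈ 𝒰 ⊎ T ∈ 𝒰
  complementary-∈ 𝒰 {S} {T} (_ , covering) with Ultrafilter.total 𝒰 S | Ultrafilter.total 𝒰 T
  ... | inj₁ S∈𝒰 | _ = inj₁ S∈𝒰
  ... | inj₂ _ | inj₁ T∈𝒰 = inj₂ T∈𝒰
  ... | inj₂ ∁S∈𝒰 | inj₂ ∁T∈𝒰 =
    inj₁ (Ultrafilter.upward 𝒰 (Ultrafilter.inter 𝒰 ∁S∈𝒰 ∁T∈𝒰)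
           (λ r ¬s×¬t → ⊥-elim (covering r (proj₁ ¬s×¬t) (proj₂ ¬s×¬t))))

  complementary-∉ : (𝒰 : Ultrafilter Ω) {S T : RoleSet Ω} → Complementary S T →
                    S ∉ 𝒰 → T ∉ 𝒰 → ⊥
  complementary-∉ 𝒰 c S∉𝒰 T∉𝒰 = [ S∉𝒰 , T∉𝒰 ]′ (complementary-∈ 𝒰 c)

module _ {A : Set₁} (P : A → Set) where

  AtMostOne : List A → Set₁
  AtMostOne [] = Lift (lsuc lzero) ⊤
  AtMostOne (x ∷ xs) = (P x → All (¬_ ∘ P) xs) × AtMostOne xs

  AtMostOne-resp-↭ : ∀ {xs ys} → xs ↭ ys → AtMostOne xs → AtMostOne ys
  AtMostOne-resp-↭ ↭.refl amo = amo
  AtMostOne-resp-↭ (prep x p) (h , amo) = (λ px → ↭.All-resp-↭ p (h px)) , AtMostOne-resp-↭ p amo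
  AtMostOne-resp-↭ (swap x y p) (hx , hy , amo) =
    (λ py → (λ px → All.head (hx px) py) ∷ ↭.All-resp-↭ p (hy py)) ,
    (λ px → ↭.All-resp-↭ p (All.tail (hx px))) , AtMostOne-resp-↭ p amo
  AtMostOne-resp-↭ (↭.trans p q) amo = AtMostOne-resp-↭ q (AtMostOne-resp-↭ p amo)

  AtMostOne-++⁺ : ∀ {xs ys} → AtMostOne xs → AtMostOne ys →
                  All (λ x → P x → All (¬_ ∘ P) ys) xs → AtMostOne (xs ++ ys)
  AtMostOne-++⁺ {[]} _ amo _ = amo
  AtMostOne-++⁺ {x ∷ xs} (h , amo) amo′ (h′ ∷ hs) =
    (λ px → All.++⁺ (h px) (h′ px)) , AtMostOne-++⁺ amo amo′ hs

  AtMostOne-++⁻ʳ : ∀ xs {ys} → AtMostOne (xs ++ ys) → AtMostOne ys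
  AtMostOne-++⁻ʳ [] amo = amo
  AtMostOne-++⁻ʳ (x ∷ xs) (_ , amo) = AtMostOne-++⁻ʳ xs amo

module _ {Ω : Set} where

  Partition : List (RoleSet Ω) → Set₁
  Partition Rs = (∀ r → Any (λ R → R r) Rs) × (∀ r → AtMostOne (λ R → R r) Rs)

  partition-resp-↭ : ∀ {Rs Qs} → Rs ↭ Qs → Partition Rs → Partition Qs
  partition-resp-↭ p (covers , disjoint) =
    (λ r → ↭.Any-resp-↭ p (covers r)) , (λ r → AtMostOne-resp-↭ _ p (disjoint r))

  partition-cut : ∀ {S S′ Ps Y Ys Qs} → Complementary S S′ → All (_≐ S′) (Y ∷ Ys) →
                  Partition (S ∷ Ps) → Partition ((Y ∷ Ys) ++ Qs) → Partition (Ps ++ Qs)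
  partition-cut {S} {S′} {Ps} {Y} {Ys} {Qs} (disjoint , covering) Ys≐S′ (covL , amoL) (covR , amoR) =
    covers , atMostOne
    where
      inS′ : ∀ {r Zs} → Any (λ R → R r) Zs → All (_≐ S′) Zs → S′ r
      inS′ (here z) (Z≐S′ ∷ _) = proj₁ Z≐S′ _ z
      inS′ (there z) (_ ∷ Zs≐S′) = inS′ z Zs≐S′

      covers : ∀ r → Any (λ R → R r) (Ps ++ Qs)
      covers r with covL r
      ... | there p = Any.++⁺ˡ p
      ... | here s with Any.++⁻ (Y ∷ Ys) (covR r)
      ...   | inj₂ q = Any.++⁺ʳ Ps q
      ...   | inj₁ y = ⊥-elim (disjoint r s (inS′ y Ys≐S′))

      atMostOne : ∀ r → AtMostOne (λ R → R r) (Ps ++ Qs)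
      atMostOne r =
        AtMostOne-++⁺ _ (proj₂ (amoL r)) (AtMostOne-++⁻ʳ _ (Y ∷ Ys) (amoR r))
          (All.tabulate λ P∈ Pr → All.tabulate λ Q∈ Qr → covering r
            (λ Sr → All.lookup (proj₁ (amoL r) Sr) P∈ Pr)
            (λ S′r → All.lookup (All.++⁻ʳ Ys (proj₁ (amoR r) (proj₂ (All.head Ys≐S′) r S′r))) Q∈ Qr))

  IsPartition⇒Partition : ∀ {Rs} → IsPartition Rs → Partition Rs
  IsPartition⇒Partition {Rs} (covers , unique) =
    (λ r → lookup⇒Any Rs (proj₂ (covers r))) , (λ r → unique⇒AtMostOne Rs (unique r))
    where
      lookup⇒Any : ∀ {r : Ω} (Rs : List (RoleSet Ω)) {i} → lookup Rs i r → Any (λ R → R r) Rs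
      lookup⇒Any (R ∷ Rs) {zero} x = here x
      lookup⇒Any (R ∷ Rs) {suc i} x = there (lookup⇒Any Rs x)

      unique⇒none : ∀ {r : Ω} (Rs : List (RoleSet Ω)) → (∀ i → ¬ lookup Rs i r) → All (λ Q → ¬ Q r) Rs
      unique⇒none [] _ = []
      unique⇒none (Q ∷ Qs) none = none zero ∷ unique⇒none Qs (none ∘ suc)

      unique⇒AtMostOne : ∀ {r : Ω} (Rs : List (RoleSet Ω)) →
                         (∀ i j → lookup Rs i r → lookup Rs j r → i ≡ j) → AtMostOne (λ R → R r) Rs
      unique⇒AtMostOne [] _ = lift tt
      unique⇒AtMostOne (R ∷ Rs) unique =
        (λ Rr → unique⇒none Rs (λ i q → 0≢1+n (unique zero (suc i) Rr q))) ,
        unique⇒AtMostOne Rs (λ i j p q → suc-injective (unique (suc i) (suc j) p q))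

  Partition⇒IsPartition : ∀ {Rs} → Partition Rs → IsPartition Rs
  Partition⇒IsPartition {Rs} (covers , amo) =
    (λ r → Any⇒lookup (covers r)) , (λ r → AtMostOne⇒unique Rs (amo r))
    where
      Any⇒lookup : ∀ {r : Ω} {Rs : List (RoleSet Ω)} → Any (λ R → R r) Rs → ∃ λ i → lookup Rs i r
      Any⇒lookup (here x) = zero , x
      Any⇒lookup (there p) = suc (proj₁ (Any⇒lookup p)) , proj₂ (Any⇒lookup p)

      none⇒¬lookup : ∀ {r : Ω} (Rs : List (RoleSet Ω)) → All (λ Q → ¬ Q r) Rs → ∀ i → ¬ lookup Rs i r
      none⇒¬lookup (_ ∷ _) (¬q ∷ _) zero = ¬q
      none⇒¬lookup (_ ∷ Rs) (_ ∷ none) (suc i) = none⇒¬lookup Rs none i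

      AtMostOne⇒unique : ∀ {r : Ω} (Rs : List (RoleSet Ω)) → AtMostOne (λ R → R r) Rs →
                         ∀ i j → lookup Rs i r → lookup Rs j r → i ≡ j
      AtMostOne⇒unique (R ∷ Rs) _ zero zero _ _ = refl
      AtMostOne⇒unique (R ∷ Rs) (h , _) zero (suc j) x y = ⊥-elim (none⇒¬lookup Rs (h x) j y)
      AtMostOne⇒unique (R ∷ Rs) (h , _) (suc i) zero x y = ⊥-elim (none⇒¬lookup Rs (h y) i x)
      AtMostOne⇒unique (R ∷ Rs) (_ , amo) (suc i) (suc j) x y =
        cong suc (AtMostOne⇒unique Rs amo i j x y)

module _ {a} {A : Set a} where

  ∈⇒↭∷ : ∀ {x : A} {xs} → x ∈ₗ xs → ∃ λ xs′ → xs ↭ x ∷ xs′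
  ∈⇒↭∷ {x} x∈xs with ∈-∃++ x∈xs
  ... | ys , zs , refl = ys ++ zs , ↭.shift x ys zs

  prepend-↭-∷ : ∀ zs {x : A} {xs ys} → xs ↭ x ∷ ys → zs ++ xs ↭ x ∷ zs ++ ys
  prepend-↭-∷ zs {x} {ys = ys} p = ↭-trans (↭.++⁺ˡ zs p) (↭.shift x zs ys)

  prepend-↭-++ : ∀ zs ys {xs ws : List A} → xs ↭ ys ++ ws → zs ++ xs ↭ ys ++ zs ++ ws
  prepend-↭-++ zs ys p = ↭-trans (↭.++⁺ˡ zs p) (↭.shifts zs ys)

  insert-↭ : ∀ zs {x : A} {xs ys} → xs ↭ x ∷ ys → x ∷ zs ++ ys ↭ zs ++ xs
  insert-↭ zs {x} {ys = ys} p = ↭-trans (↭-sym (↭.shift x zs ys)) (↭.++⁺ˡ zs (↭-sym p))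

  ∷-↭-∷-cases : ∀ {x y : A} {xs ys} → x ∷ xs ↭ y ∷ ys →
                (x ≡ y × xs ↭ ys) ⊎ ∃ λ zs → (xs ↭ y ∷ zs) × (ys ↭ x ∷ zs)
  ∷-↭-∷-cases {x} {y} p with ↭.∈-resp-↭ (↭-sym p) (here {x = y} refl)
  ... | here refl = inj₁ (refl , ↭.drop-∷ p)
  ... | there y∈xs with ∈⇒↭∷ y∈xs
  ...   | zs , q = inj₂ (zs , q , ↭-sym (↭.drop-∷ (↭-trans (↭-sym (prepend-↭-∷ (x ∷ []) q)) p)))

  ∷-↭-++-cases : ∀ {x : A} {xs} ys {zs} → x ∷ xs ↭ ys ++ zs →
                 (∃ λ ys′ → (ys ↭ x ∷ ys′) × (xs ↭ ys′ ++ zs)) ⊎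
                 (∃ λ zs′ → (zs ↭ x ∷ zs′) × (xs ↭ ys ++ zs′))
  ∷-↭-++-cases {x} ys {zs} p with ∈-++⁻ ys (↭.∈-resp-↭ p (here {x = x} refl))
  ... | inj₁ x∈ys with ∈⇒↭∷ x∈ys
  ...   | ys′ , q = inj₁ (ys′ , q , ↭.drop-∷ (↭-trans p (↭.++⁺ʳ zs q)))
  ∷-↭-++-cases {x} ys {zs} p | inj₂ x∈zs with ∈⇒↭∷ x∈zs
  ...   | zs′ , q = inj₂ (zs′ , q , ↭.drop-∷ (↭-trans p (↭-trans (↭.++⁺ˡ ys q) (↭.shift x ys zs′))))

  record ++-↭-++-Split (xs₁ xs₂ ys zs : List A) : Set a where
    field
      ys₁ ys₂ zs₁ zs₂ : List A
      xs₁↭ : xs₁ ↭ ys₁ ++ zs₁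
      xs₂↭ : xs₂ ↭ ys₂ ++ zs₂
      ys↭ : ys ↭ ys₁ ++ ys₂
      zs↭ : zs ↭ zs₁ ++ zs₂

  ++-↭-++-split : ∀ xs₁ {xs₂} ys {zs} → xs₁ ++ xs₂ ↭ ys ++ zs → ++-↭-++-Split xs₁ xs₂ ys zs
  ++-↭-++-split [] ys {zs} p = record
    { ys₁ = [] ; ys₂ = ys ; zs₁ = [] ; zs₂ = zs
    ; xs₁↭ = ↭-refl ; xs₂↭ = p ; ys↭ = ↭-refl ; zs↭ = ↭-refl }
  ++-↭-++-split (x ∷ xs₁) ys p with ∷-↭-++-cases ys p
  ... | inj₁ (ys′ , q , p′) = let open ++-↭-++-Split (++-↭-++-split xs₁ ys′ p′) in record
    { ys₁ = x ∷ ys₁ ; ys₂ = ys₂ ; zs₁ = zs₁ ; zs₂ = zs₂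
    ; xs₁↭ = prep x xs₁↭ ; xs₂↭ = xs₂↭ ; ys↭ = ↭-trans q (prep x ys↭) ; zs↭ = zs↭ }
  ... | inj₂ (zs′ , q , p′) = let open ++-↭-++-Split (++-↭-++-split xs₁ ys p′) in record
    { ys₁ = ys₁ ; ys₂ = ys₂ ; zs₁ = x ∷ zs₁ ; zs₂ = zs₂
    ; xs₁↭ = ↭-trans (prep x xs₁↭) (↭-sym (↭.shift x ys₁ zs₁)) ; xs₂↭ = xs₂↭
    ; ys↭ = ys↭ ; zs↭ = ↭-trans q (prep x zs↭) }

  module ↭-Solver = CommutativeMonoidSolver (↭.++-commutativeMonoid {A = A})

module _ {a ℓ} {A : Set a} {R : A → A → Set ℓ} where

  Pointwise-↭ : ∀ {xs ys zs} → Pointwise R xs ys → ys ↭ zs →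
                ∃ λ xs′ → (xs ↭ xs′) × Pointwise R xs′ zs
  Pointwise-↭ p ↭.refl = _ , ↭-refl , p
  Pointwise-↭ (r ∷ p) (prep x q) with Pointwise-↭ p q
  ... | _ , s , p′ = _ , prep _ s , r ∷ p′
  Pointwise-↭ (r ∷ r′ ∷ p) (swap x y q) with Pointwise-↭ p q
  ... | _ , s , p′ = _ , swap _ _ s , r′ ∷ r ∷ p′
  Pointwise-↭ p (↭.trans q q′) with Pointwise-↭ p q
  ... | _ , s , p′ with Pointwise-↭ p′ q′
  ...   | xs″ , s′ , p″ = xs″ , ↭-trans s s′ , p″

  Pointwise-++ʳ-split : ∀ {xs} ys {zs} → Pointwise R xs (ys ++ zs) →
    ∃ λ xs₁ → ∃ λ xs₂ → (xs ≡ xs₁ ++ xs₂) × Pointwise R xs₁ ys × Pointwise R xs₂ zs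
  Pointwise-++ʳ-split [] p = [] , _ , refl , [] , p
  Pointwise-++ʳ-split (y ∷ ys) (r ∷ p) with Pointwise-++ʳ-split ys p
  ... | xs₁ , xs₂ , refl , p₁ , p₂ = _ ∷ xs₁ , xs₂ , refl , r ∷ p₁ , p₂

module _ {Fun : Set} where

  mutual
    subT-cong : {σ τ : ℕ → Term Fun} → (∀ i → σ i ≡ τ i) → ∀ t → subT σ t ≡ subT τ t
    subT-cong σ≗τ (var i) = σ≗τ i
    subT-cong σ≗τ (fn g ts) = cong (fn g) (subTs-cong σ≗τ ts)

    subTs-cong : {σ τ : ℕ → Term Fun} → (∀ i → σ i ≡ τ i) → ∀ ts → subTs σ ts ≡ subTs τ ts
    subTs-cong σ≗τ [] = refl
    subTs-cong σ≗τ (t ∷ ts) = cong₂ _∷_ (subT-cong σ≗τ t) (subTs-cong σ≗τ ts)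

  mutual
    subT-var : ∀ (t : Term Fun) → subT var t ≡ t
    subT-var (var i) = refl
    subT-var (fn g ts) = cong (fn g) (subTs-var ts)

    subTs-var : ∀ (ts : List (Term Fun)) → subTs var ts ≡ ts
    subTs-var [] = refl
    subTs-var (t ∷ ts) = cong₂ _∷_ (subT-var t) (subTs-var ts)

  mutual
    subT-subT : (σ τ : ℕ → Term Fun) → ∀ t → subT σ (subT τ t) ≡ subT (subT σ ∘ τ) t
    subT-subT σ τ (var i) = refl
    subT-subT σ τ (fn g ts) = cong (fn g) (subTs-subTs σ τ ts)

    subTs-subTs : (σ τ : ℕ → Term Fun) → ∀ ts → subTs σ (subTs τ ts) ≡ subTs (subT σ ∘ τ) ts
    subTs-subTs σ τ [] = refl
    subTs-subTs σ τ (t ∷ ts) = cong₂ _∷_ (subT-subT σ τ t) (subTs-subTs σ τ ts)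

  mutual
    renT-subT : (ρ : ℕ → ℕ) → ∀ (t : Term Fun) → renT ρ t ≡ subT (var ∘ ρ) t
    renT-subT ρ (var i) = refl
    renT-subT ρ (fn g ts) = cong (fn g) (renTs-subTs ρ ts)

    renTs-subTs : (ρ : ℕ → ℕ) → ∀ (ts : List (Term Fun)) → renTs ρ ts ≡ subTs (var ∘ ρ) ts
    renTs-subTs ρ [] = refl
    renTs-subTs ρ (t ∷ ts) = cong₂ _∷_ (renT-subT ρ t) (renTs-subTs ρ ts)

module Formulas (Ω Fun Pred : Set) where
  open MRLJ Ω Fun Pred

  infix 4 _≅_
  data _≅_ : Formula → Formula → Set₁ where
    atom≅ : ∀ {p ts} → atom p ts ≅ atom p ts
    ¬≅ : ∀ {f g A B} → (∀ r → f r ≡ g r) → A ≅ B → ¬[ f ] A ≅ ¬[ g ] B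
    ∧≅ : ∀ {A B C D 𝒰 𝒱} → A ≅ C → 𝒰 ≈ᵤ 𝒱 → B ≅ D → A ∧[ 𝒰 ] B ≅ C ∧[ 𝒱 ] D
    ⊃≅ : ∀ {A B C D f g 𝒰 𝒱} → A ≅ C → (∀ r → f r ≡ g r) → 𝒰 ≈ᵤ 𝒱 → B ≅ D →
         A ⊃[ f , 𝒰 ] B ≅ C ⊃[ g , 𝒱 ] D
    ∀≅ : ∀ {A B 𝒰 𝒱} → 𝒰 ≈ᵤ 𝒱 → A ≅ B → ∀[ 𝒰 ] A ≅ ∀[ 𝒱 ] B

  ≅-refl : ∀ {A} → A ≅ A
  ≅-refl {atom p ts} = atom≅
  ≅-refl {¬[ f ] A} = ¬≅ (λ r → refl) ≅-refl
  ≅-refl {A ∧[ 𝒰 ] B} = ∧≅ ≅-refl ≈ᵤ-refl ≅-refl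
  ≅-refl {A ⊃[ f , 𝒰 ] B} = ⊃≅ ≅-refl (λ r → refl) ≈ᵤ-refl ≅-refl
  ≅-refl {∀[ 𝒰 ] A} = ∀≅ ≈ᵤ-refl ≅-refl

  ≅-sym : ∀ {A B} → A ≅ B → B ≅ A
  ≅-sym atom≅ = atom≅
  ≅-sym (¬≅ e p) = ¬≅ (λ r → sym (e r)) (≅-sym p)
  ≅-sym (∧≅ p u q) = ∧≅ (≅-sym p) (≈ᵤ-sym u) (≅-sym q)
  ≅-sym (⊃≅ p e u q) = ⊃≅ (≅-sym p) (λ r → sym (e r)) (≈ᵤ-sym u) (≅-sym q)
  ≅-sym (∀≅ u p) = ∀≅ (≈ᵤ-sym u) (≅-sym p)

  ≅-trans : ∀ {A B C} → A ≅ B → B ≅ C → A ≅ C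
  ≅-trans atom≅ atom≅ = atom≅
  ≅-trans (¬≅ e p) (¬≅ e′ p′) = ¬≅ (λ r → ≡.trans (e r) (e′ r)) (≅-trans p p′)
  ≅-trans (∧≅ p u q) (∧≅ p′ u′ q′) = ∧≅ (≅-trans p p′) (≈ᵤ-trans u u′) (≅-trans q q′)
  ≅-trans (⊃≅ p e u q) (⊃≅ p′ e′ u′ q′) =
    ⊃≅ (≅-trans p p′) (λ r → ≡.trans (e r) (e′ r)) (≈ᵤ-trans u u′) (≅-trans q q′)
  ≅-trans (∀≅ u p) (∀≅ u′ p′) = ∀≅ (≈ᵤ-trans u u′) (≅-trans p p′)

  ≅⇒≈F : ∀ {A B} → A ≅ B → A ≈F B
  ≅⇒≈F atom≅ = lift (refl , refl)
  ≅⇒≈F (¬≅ e p) = lift e , ≅⇒≈F p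
  ≅⇒≈F (∧≅ p u q) = ≅⇒≈F p , same-members u , ≅⇒≈F q
  ≅⇒≈F (⊃≅ p e u q) = ≅⇒≈F p , lift e , same-members u , ≅⇒≈F q
  ≅⇒≈F (∀≅ u p) = same-members u , ≅⇒≈F p

  ≈F⇒≅ : ∀ A B → A ≈F B → A ≅ B
  ≈F⇒≅ (atom p ts) (atom q us) (lift (refl , refl)) = atom≅
  ≈F⇒≅ (¬[ f ] A) (¬[ g ] B) (lift e , p) = ¬≅ e (≈F⇒≅ A B p)
  ≈F⇒≅ (A ∧[ 𝒰 ] B) (C ∧[ 𝒱 ] D) (p , u , q) = ∧≅ (≈F⇒≅ A C p) (mk≈ᵤ u) (≈F⇒≅ B D q)
  ≈F⇒≅ (A ⊃[ f , 𝒰 ] B) (C ⊃[ g , 𝒱 ] D) (p , lift e , u , q) =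
    ⊃≅ (≈F⇒≅ A C p) e (mk≈ᵤ u) (≈F⇒≅ B D q)
  ≈F⇒≅ (∀[ 𝒰 ] A) (∀[ 𝒱 ] B) (u , p) = ∀≅ (mk≈ᵤ u) (≈F⇒≅ A B p)
  ≈F⇒≅ (atom _ _) (¬[ _ ] _) (lift ())
  ≈F⇒≅ (atom _ _) (_ ∧[ _ ] _) (lift ())
  ≈F⇒≅ (atom _ _) (_ ⊃[ _ , _ ] _) (lift ())
  ≈F⇒≅ (atom _ _) (∀[ _ ] _) (lift ())
  ≈F⇒≅ (¬[ _ ] _) (atom _ _) (lift ())
  ≈F⇒≅ (¬[ _ ] _) (_ ∧[ _ ] _) (lift ())
  ≈F⇒≅ (¬[ _ ] _) (_ ⊃[ _ , _ ] _) (lift ())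
  ≈F⇒≅ (¬[ _ ] _) (∀[ _ ] _) (lift ())
  ≈F⇒≅ (_ ∧[ _ ] _) (atom _ _) (lift ())
  ≈F⇒≅ (_ ∧[ _ ] _) (¬[ _ ] _) (lift ())
  ≈F⇒≅ (_ ∧[ _ ] _) (_ ⊃[ _ , _ ] _) (lift ())
  ≈F⇒≅ (_ ∧[ _ ] _) (∀[ _ ] _) (lift ())
  ≈F⇒≅ (_ ⊃[ _ , _ ] _) (atom _ _) (lift ())
  ≈F⇒≅ (_ ⊃[ _ , _ ] _) (¬[ _ ] _) (lift ())
  ≈F⇒≅ (_ ⊃[ _ , _ ] _) (_ ∧[ _ ] _) (lift ())
  ≈F⇒≅ (_ ⊃[ _ , _ ] _) (∀[ _ ] _) (lift ())
  ≈F⇒≅ (∀[ _ ] _) (atom _ _) (lift ())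
  ≈F⇒≅ (∀[ _ ] _) (¬[ _ ] _) (lift ())
  ≈F⇒≅ (∀[ _ ] _) (_ ∧[ _ ] _) (lift ())
  ≈F⇒≅ (∀[ _ ] _) (_ ⊃[ _ , _ ] _) (lift ())

  -- The measure of the cut induction: unlike the formula itself, it is invariant
  -- under ≅ and under substitution, so A [ t ] is smaller than ∀[ 𝒰 ] A.
  data Shape : Set where
    atomₛ : Shape
    ¬ₛ ∀ₛ : Shape → Shape
    _∧ₛ_ _⊃ₛ_ : Shape → Shape → Shape

  data HasShape : Formula → Shape → Set₁ where
    atomʰ : ∀ {p ts} → HasShape (atom p ts) atomₛ
    ¬ʰ : ∀ {f A s} → HasShape A s → HasShape (¬[ f ] A) (¬ₛ s)
    ∧ʰ : ∀ {A B 𝒰 s t} → HasShape A s → HasShape B t → HasShape (A ∧[ 𝒰 ] B) (s ∧ₛ t)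
    ⊃ʰ : ∀ {A B f 𝒰 s t} → HasShape A s → HasShape B t → HasShape (A ⊃[ f , 𝒰 ] B) (s ⊃ₛ t)
    ∀ʰ : ∀ {A 𝒰 s} → HasShape A s → HasShape (∀[ 𝒰 ] A) (∀ₛ s)

  shape : Formula → Shape
  shape (atom p ts) = atomₛ
  shape (¬[ f ] A) = ¬ₛ (shape A)
  shape (A ∧[ 𝒰 ] B) = shape A ∧ₛ shape B
  shape (A ⊃[ f , 𝒰 ] B) = shape A ⊃ₛ shape B
  shape (∀[ 𝒰 ] A) = ∀ₛ (shape A)

  hasShape : ∀ A → HasShape A (shape A)
  hasShape (atom p ts) = atomʰ
  hasShape (¬[ f ] A) = ¬ʰ (hasShape A)
  hasShape (A ∧[ 𝒰 ] B) = ∧ʰ (hasShape A) (hasShape B)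
  hasShape (A ⊃[ f , 𝒰 ] B) = ⊃ʰ (hasShape A) (hasShape B)
  hasShape (∀[ 𝒰 ] A) = ∀ʰ (hasShape A)

  HasShape-resp-≅ : ∀ {A B s} → A ≅ B → HasShape A s → HasShape B s
  HasShape-resp-≅ atom≅ atomʰ = atomʰ
  HasShape-resp-≅ (¬≅ _ p) (¬ʰ a) = ¬ʰ (HasShape-resp-≅ p a)
  HasShape-resp-≅ (∧≅ p _ q) (∧ʰ a b) = ∧ʰ (HasShape-resp-≅ p a) (HasShape-resp-≅ q b)
  HasShape-resp-≅ (⊃≅ p _ _ q) (⊃ʰ a b) = ⊃ʰ (HasShape-resp-≅ p a) (HasShape-resp-≅ q b)
  HasShape-resp-≅ (∀≅ _ p) (∀ʰ a) = ∀ʰ (HasShape-resp-≅ p a)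

  HasShape-subF : ∀ {A s} (σ : ℕ → Term Fun) → HasShape A s → HasShape (subF σ A) s
  HasShape-subF σ atomʰ = atomʰ
  HasShape-subF σ (¬ʰ a) = ¬ʰ (HasShape-subF σ a)
  HasShape-subF σ (∧ʰ a b) = ∧ʰ (HasShape-subF σ a) (HasShape-subF σ b)
  HasShape-subF σ (⊃ʰ a b) = ⊃ʰ (HasShape-subF σ a) (HasShape-subF σ b)
  HasShape-subF σ (∀ʰ a) = ∀ʰ (HasShape-subF (liftS σ) a)

  ≅-subF : ∀ {A B} (σ : ℕ → Term Fun) → A ≅ B → subF σ A ≅ subF σ B
  ≅-subF σ atom≅ = atom≅
  ≅-subF σ (¬≅ e p) = ¬≅ e (≅-subF σ p)
  ≅-subF σ (∧≅ p u q) = ∧≅ (≅-subF σ p) u (≅-subF σ q)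
  ≅-subF σ (⊃≅ p e u q) = ⊃≅ (≅-subF σ p) e u (≅-subF σ q)
  ≅-subF σ (∀≅ u p) = ∀≅ u (≅-subF (liftS σ) p)

  liftS-cong : {σ τ : ℕ → Term Fun} → (∀ i → σ i ≡ τ i) → ∀ i → liftS σ i ≡ liftS τ i
  liftS-cong σ≗τ zero = refl
  liftS-cong σ≗τ (suc i) = cong (renT suc) (σ≗τ i)

  subF-cong : {σ τ : ℕ → Term Fun} → (∀ i → σ i ≡ τ i) → ∀ A → subF σ A ≡ subF τ A
  subF-cong e (atom p ts) = cong (atom p) (subTs-cong e ts)
  subF-cong e (¬[ f ] A) = cong (¬[ f ]_) (subF-cong e A)
  subF-cong e (A ∧[ 𝒰 ] B) = cong₂ (_∧[ 𝒰 ]_) (subF-cong e A) (subF-cong e B)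
  subF-cong e (A ⊃[ f , 𝒰 ] B) = cong₂ (_⊃[ f , 𝒰 ]_) (subF-cong e A) (subF-cong e B)
  subF-cong e (∀[ 𝒰 ] A) = cong ∀[ 𝒰 ] (subF-cong (liftS-cong e) A)

  liftS-var : ∀ i → liftS {Fun} var i ≡ var i
  liftS-var zero = refl
  liftS-var (suc i) = refl

  subF-var : ∀ A → subF var A ≡ A
  subF-var (atom p ts) = cong (atom p) (subTs-var ts)
  subF-var (¬[ f ] A) = cong (¬[ f ]_) (subF-var A)
  subF-var (A ∧[ 𝒰 ] B) = cong₂ (_∧[ 𝒰 ]_) (subF-var A) (subF-var B)
  subF-var (A ⊃[ f , 𝒰 ] B) = cong₂ (_⊃[ f , 𝒰 ]_) (subF-var A) (subF-var B)
  subF-var (∀[ 𝒰 ] A) = cong ∀[ 𝒰 ] (≡.trans (subF-cong liftS-var A) (subF-var A))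

  liftS-subT : (σ τ : ℕ → Term Fun) → ∀ i →
               subT (liftS σ) (liftS τ i) ≡ liftS (subT σ ∘ τ) i
  liftS-subT σ τ zero = refl
  liftS-subT σ τ (suc i) = begin
    subT (liftS σ) (renT suc (τ i))          ≡⟨ cong (subT (liftS σ)) (renT-subT suc (τ i)) ⟩
    subT (liftS σ) (subT (var ∘ suc) (τ i))  ≡⟨ subT-subT (liftS σ) (var ∘ suc) (τ i) ⟩
    subT (renT suc ∘ σ) (τ i)                ≡⟨ subT-cong (λ k → renT-subT suc (σ k)) (τ i) ⟩
    subT (subT (var ∘ suc) ∘ σ) (τ i)        ≡⟨ subT-subT (var ∘ suc) σ (τ i) ⟨
    subT (var ∘ suc) (subT σ (τ i))          ≡⟨ renT-subT suc (subT σ (τ i)) ⟨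
    renT suc (subT σ (τ i))                  ∎
    where open ≡.≡-Reasoning

  subF-subF : (σ τ : ℕ → Term Fun) → ∀ A → subF σ (subF τ A) ≡ subF (subT σ ∘ τ) A
  subF-subF σ τ (atom p ts) = cong (atom p) (subTs-subTs σ τ ts)
  subF-subF σ τ (¬[ f ] A) = cong (¬[ f ]_) (subF-subF σ τ A)
  subF-subF σ τ (A ∧[ 𝒰 ] B) = cong₂ (_∧[ 𝒰 ]_) (subF-subF σ τ A) (subF-subF σ τ B)
  subF-subF σ τ (A ⊃[ f , 𝒰 ] B) = cong₂ (_⊃[ f , 𝒰 ]_) (subF-subF σ τ A) (subF-subF σ τ B)
  subF-subF σ τ (∀[ 𝒰 ] A) =
    cong ∀[ 𝒰 ] (≡.trans (subF-subF (liftS σ) (liftS τ) A) (subF-cong (liftS-subT σ τ) A))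

  liftR-var : (ρ : ℕ → ℕ) → ∀ i → var {Fun} (liftR {Fun} ρ i) ≡ liftS (var ∘ ρ) i
  liftR-var ρ zero = refl
  liftR-var ρ (suc i) = refl

  renF-subF : (ρ : ℕ → ℕ) → ∀ A → renF ρ A ≡ subF (var ∘ ρ) A
  renF-subF ρ (atom p ts) = cong (atom p) (renTs-subTs ρ ts)
  renF-subF ρ (¬[ f ] A) = cong (¬[ f ]_) (renF-subF ρ A)
  renF-subF ρ (A ∧[ 𝒰 ] B) = cong₂ (_∧[ 𝒰 ]_) (renF-subF ρ A) (renF-subF ρ B)
  renF-subF ρ (A ⊃[ f , 𝒰 ] B) = cong₂ (_⊃[ f , 𝒰 ]_) (renF-subF ρ A) (renF-subF ρ B)
  renF-subF ρ (∀[ 𝒰 ] A) =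
    cong ∀[ 𝒰 ] (≡.trans (renF-subF (liftR {Fun} ρ) A) (subF-cong (liftR-var ρ) A))

  subF-liftS-shift : (σ : ℕ → Term Fun) → ∀ A → subF (liftS σ) (renF suc A) ≡ renF suc (subF σ A)
  subF-liftS-shift σ A = begin
    subF (liftS σ) (renF suc A)          ≡⟨ cong (subF (liftS σ)) (renF-subF suc A) ⟩
    subF (liftS σ) (subF (var ∘ suc) A)  ≡⟨ subF-subF (liftS σ) (var ∘ suc) A ⟩
    subF (renT suc ∘ σ) A                ≡⟨ subF-cong (λ i → renT-subT suc (σ i)) A ⟩
    subF (subT (var ∘ suc) ∘ σ) A        ≡⟨ subF-subF (var ∘ suc) σ A ⟨
    subF (var ∘ suc) (subF σ A)          ≡⟨ renF-subF suc (subF σ A) ⟨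
    renF suc (subF σ A)                  ∎
    where open ≡.≡-Reasoning

  subF-[] : (σ : ℕ → Term Fun) (t : Term Fun) → ∀ A →
            subF σ (A [ t ]) ≡ (subF (liftS σ) A) [ subT σ t ]
  subF-[] σ t A = begin
    subF σ (A [ t ])                                 ≡⟨ subF-subF σ (inst t) A ⟩
    subF (subT σ ∘ inst t) A                         ≡⟨ subF-cong inst-liftS A ⟩
    subF (subT (inst (subT σ t)) ∘ liftS σ) A         ≡⟨ subF-subF (inst (subT σ t)) (liftS σ) A ⟨
    (subF (liftS σ) A) [ subT σ t ]                    ∎
    where
      open ≡.≡-Reasoning
      inst-liftS : ∀ i → subT σ (inst t i) ≡ subT (inst (subT σ t)) (liftS σ i)
      inst-liftS zero = refl
      inst-liftS (suc i) = sym (begin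
        subT τ (renT suc (σ i))          ≡⟨ cong (subT τ) (renT-subT suc (σ i)) ⟩
        subT τ (subT (var ∘ suc) (σ i))  ≡⟨ subT-subT τ (var ∘ suc) (σ i) ⟩
        subT var (σ i)                   ≡⟨ subT-var (σ i) ⟩
        σ i                              ∎)
        where τ = inst (subT σ t)

  renF-suc-[] : (t : Term Fun) → ∀ A → (renF suc A) [ t ] ≡ A
  renF-suc-[] t A = begin
    (renF suc A) [ t ]                 ≡⟨ cong (subF (inst t)) (renF-subF suc A) ⟩
    subF (inst t) (subF (var ∘ suc) A) ≡⟨ subF-subF (inst t) (var ∘ suc) A ⟩
    subF var A                       ≡⟨ subF-var A ⟩
    A                                ∎
    where open ≡.≡-Reasoning

module Derivations (Ω Fun Pred : Set) (𝒥 : Ultrafilter Ω) where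
  open MRLJ Ω Fun Pred hiding (⊢_; Intuitionistic)
  open Formulas Ω Fun Pred
  open ↭-Solver {A = IFormula} using (solve; _⊜_; _⊕_)

  infix 2 ⊢_
  ⊢_ : Sequent → Set₁
  ⊢ Γ = MRLJ.⊢_ Ω Fun Pred 𝒥 Γ

  Intuitionistic : Sequent → Set₁
  Intuitionistic = MRLJ.Intuitionistic Ω Fun Pred 𝒥

  𝒥-Free : Sequent → Set₁
  𝒥-Free = All (λ X → role X ∉ 𝒥)

  intuitionistic-++ : ∀ {Γ Δ} → 𝒥-Free Γ → Intuitionistic Δ → Intuitionistic (Γ ++ Δ)
  intuitionistic-++ [] i = i
  intuitionistic-++ (X∉𝒥 ∷ Γ∉𝒥) i = (λ X∈𝒥 → ⊥-elim (X∉𝒥 X∈𝒥)) , intuitionistic-++ Γ∉𝒥 i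

  intuitionistic-++⁻ʳ : ∀ Γ {Δ} → Intuitionistic (Γ ++ Δ) → Intuitionistic Δ
  intuitionistic-++⁻ʳ [] i = i
  intuitionistic-++⁻ʳ (X ∷ Γ) (_ , i) = intuitionistic-++⁻ʳ Γ i

  intuitionistic-resp-↭ : ∀ {Γ Δ} → Γ ↭ Δ → Intuitionistic Γ → Intuitionistic Δ
  intuitionistic-resp-↭ p = fromAtMostOne _ ∘ AtMostOne-resp-↭ _ p ∘ toAtMostOne _
    where
      toAtMostOne : ∀ Γ → Intuitionistic Γ → AtMostOne (λ X → role X ∈ 𝒥) Γ
      toAtMostOne [] i = i
      toAtMostOne (X ∷ Γ) (h , i) = h , toAtMostOne Γ i

      fromAtMostOne : ∀ Γ → AtMostOne (λ X → role X ∈ 𝒥) Γ → Intuitionistic Γ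
      fromAtMostOne [] i = i
      fromAtMostOne (X ∷ Γ) (h , i) = h , fromAtMostOne Γ i

  infix 4 _≈ᵢ_ _≋_
  _≈ᵢ_ : IFormula → IFormula → Set₁
  X ≈ᵢ Y = Lift (lsuc lzero) (role X ≐ role Y) × (form X ≅ form Y)

  ≈ᵢ-refl : ∀ {X} → X ≈ᵢ X
  ≈ᵢ-refl = lift ≐-refl , ≅-refl

  ≈ᵢ-trans : ∀ {X Y Z} → X ≈ᵢ Y → Y ≈ᵢ Z → X ≈ᵢ Z
  ≈ᵢ-trans (lift R≐S , A≅B) (lift S≐T , B≅C) = lift (≐-trans R≐S S≐T) , ≅-trans A≅B B≅C

  _≋_ : Sequent → Sequent → Set₁
  _≋_ = Pointwise _≈ᵢ_

  ≋-refl : ∀ {Γ} → Γ ≋ Γ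
  ≋-refl = Pointwise.refl ≈ᵢ-refl

  ≈I⇒≋ : ∀ {Γ Δ} → Pointwise _≈I_ Γ Δ → Γ ≋ Δ
  ≈I⇒≋ = Pointwise.map λ { {_ ⟪ A ⟫} {_ ⟪ B ⟫} (R≐S , A≈B) → R≐S , ≈F⇒≅ A B A≈B }

  ⊢-resp-≋ : ∀ {Γ Δ} → Γ ≋ Δ → ⊢ Γ → ⊢ Δ
  ⊢-resp-≋ Γ≋Δ = ext (Pointwise.map (λ { {_ ⟪ _ ⟫} {_ ⟪ _ ⟫} (R≐S , A≅B) → R≐S , ≅⇒≈F A≅B }) Γ≋Δ)

  intuitionistic-resp-≋ : ∀ {Γ Δ} → Γ ≋ Δ → Intuitionistic Γ → Intuitionistic Δ
  intuitionistic-resp-≋ [] i = i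
  intuitionistic-resp-≋ ((lift R≐S , _) ∷ Γ≋Δ) (h , i) =
    (λ S∈𝒥 → 𝒥-free-resp-≋ Γ≋Δ (h (∈-resp-≐ 𝒥 (≐-sym R≐S) S∈𝒥))) , intuitionistic-resp-≋ Γ≋Δ i
    where
      𝒥-free-resp-≋ : ∀ {Γ Δ} → Γ ≋ Δ → 𝒥-Free Γ → 𝒥-Free Δ
      𝒥-free-resp-≋ [] [] = []
      𝒥-free-resp-≋ ((lift R≐S , _) ∷ Γ≋Δ) (R∉𝒥 ∷ Γ∉𝒥) =
        (R∉𝒥 ∘ ∈-resp-≐ 𝒥 (≐-sym R≐S)) ∷ 𝒥-free-resp-≋ Γ≋Δ Γ∉𝒥

  ⊢⇒intuitionistic : ∀ {Γ} → ⊢ Γ → Intuitionistic Γ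
  ⊢⇒intuitionistic (exch p d) = intuitionistic-resp-↭ p (⊢⇒intuitionistic d)
  ⊢⇒intuitionistic (ext p d) = intuitionistic-resp-≋ (≈I⇒≋ p) (⊢⇒intuitionistic d)
  ⊢⇒intuitionistic (Id _ _ _ _ i) = i
  ⊢⇒intuitionistic (Weaken _ _ i _) = i
  ⊢⇒intuitionistic (Contract _ _ i _) = i
  ⊢⇒intuitionistic (Neg _ _ _ i _) = i
  ⊢⇒intuitionistic (∧-neg-l _ _ _ _ _ i _) = i
  ⊢⇒intuitionistic (∧-neg-r _ _ _ _ _ i _) = i
  ⊢⇒intuitionistic (∧-pos _ _ _ _ _ i _ _) = i
  ⊢⇒intuitionistic (∀-neg _ _ _ _ _ i _) = i
  ⊢⇒intuitionistic (∀-pos _ _ _ _ i _) = i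
  ⊢⇒intuitionistic (⊃-neg _ _ _ _ _ _ i _) = i
  ⊢⇒intuitionistic (⊃-pos _ _ _ _ _ _ i _ _) = i

  weaken* : ∀ Θ {Γ} → Intuitionistic (Θ ++ Γ) → ⊢ Γ → ⊢ Θ ++ Γ
  weaken* [] _ d = d
  weaken* (X ∷ Θ) i d = Weaken (role X) (form X) i (weaken* Θ (proj₂ i) d)

  contract* : ∀ Γ Ψ → ⊢ Γ ++ Γ ++ Ψ → ⊢ Γ ++ Ψ
  contract* [] Ψ d = d
  contract* (X ∷ Γ) Ψ d = Contract (role X) (form X) (drop-second {X} {X} (⊢⇒intuitionistic d′)) d′
    where
      x = X ∷ []
      d′ : ⊢ X ∷ X ∷ Γ ++ Ψ
      d′ = exch (solve 3 (λ g x p → g ⊕ x ⊕ x ⊕ p ⊜ x ⊕ x ⊕ g ⊕ p) ↭-refl Γ x Ψ)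
             (contract* Γ (X ∷ X ∷ Ψ)
               (exch (solve 3 (λ x g p → x ⊕ g ⊕ x ⊕ g ⊕ p ⊜ g ⊕ g ⊕ x ⊕ x ⊕ p) ↭-refl x Γ Ψ) d))
      drop-second : ∀ {X Y Γ} → Intuitionistic (X ∷ Y ∷ Γ) → Intuitionistic (X ∷ Γ)
      drop-second (h , _ , i) = (λ X∈𝒥 → All.tail (h X∈𝒥)) , i

  subI : (ℕ → Term Fun) → IFormula → IFormula
  subI σ X = role X ⟪ subF σ (form X) ⟫

  subΓ : (ℕ → Term Fun) → Sequent → Sequent
  subΓ σ = map (subI σ)

  intuitionistic-subΓ : ∀ σ {Γ} → Intuitionistic Γ → Intuitionistic (subΓ σ Γ)
  intuitionistic-subΓ σ {[]} i = i
  intuitionistic-subΓ σ {X ∷ Γ} (h , i) = (All.map⁺ ∘ h) , intuitionistic-subΓ σ i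

  ≋-subΓ : ∀ σ {Γ Δ} → Γ ≋ Δ → subΓ σ Γ ≋ subΓ σ Δ
  ≋-subΓ σ [] = []
  ≋-subΓ σ ((R≐S , A≅B) ∷ Γ≋Δ) = (R≐S , ≅-subF σ A≅B) ∷ ≋-subΓ σ Γ≋Δ

  subΓ-shiftΓ : ∀ σ Γ → subΓ (liftS σ) (shiftΓ Γ) ≡ shiftΓ (subΓ σ Γ)
  subΓ-shiftΓ σ [] = refl
  subΓ-shiftΓ σ (X ∷ Γ) = cong₂ _∷_ (cong (role X ⟪_⟫) (subF-liftS-shift σ (form X))) (subΓ-shiftΓ σ Γ)

  ⊢-subst : ∀ σ {Γ} → ⊢ Γ → ⊢ subΓ σ Γ
  ⊢-subst σ (exch p d) = exch (↭.map⁺ _ p) (⊢-subst σ d)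
  ⊢-subst σ (ext p d) = ⊢-resp-≋ (≋-subΓ σ (≈I⇒≋ p)) (⊢-subst σ d)
  ⊢-subst σ (Id p ts Rs part i) =
    subst ⊢_ (List.map-∘ Rs)
      (Id p (subTs σ ts) Rs part (subst Intuitionistic (sym (List.map-∘ Rs)) (intuitionistic-subΓ σ i)))
  ⊢-subst σ (Weaken {Γ} R A i d) =
    Weaken R (subF σ A) (intuitionistic-subΓ σ {R ⟪ A ⟫ ∷ Γ} i) (⊢-subst σ d)
  ⊢-subst σ (Contract {Γ} R A i d) =
    Contract R (subF σ A) (intuitionistic-subΓ σ {R ⟪ A ⟫ ∷ Γ} i) (⊢-subst σ d)
  ⊢-subst σ (Neg {Γ} R f A i d) =
    Neg R f (subF σ A) (intuitionistic-subΓ σ {R ⟪ ¬[ f ] A ⟫ ∷ Γ} i) (⊢-subst σ d)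
  ⊢-subst σ (∧-neg-l {Γ} R 𝒰 A B R∉𝒰 i d) =
    ∧-neg-l R 𝒰 (subF σ A) (subF σ B) R∉𝒰 (intuitionistic-subΓ σ {R ⟪ A ∧[ 𝒰 ] B ⟫ ∷ Γ} i) (⊢-subst σ d)
  ⊢-subst σ (∧-neg-r {Γ} R 𝒰 A B R∉𝒰 i d) =
    ∧-neg-r R 𝒰 (subF σ A) (subF σ B) R∉𝒰 (intuitionistic-subΓ σ {R ⟪ A ∧[ 𝒰 ] B ⟫ ∷ Γ} i) (⊢-subst σ d)
  ⊢-subst σ (∧-pos {Γ} R 𝒰 A B R∈𝒰 i d d′) =
    ∧-pos R 𝒰 (subF σ A) (subF σ B) R∈𝒰 (intuitionistic-subΓ σ {R ⟪ A ∧[ 𝒰 ] B ⟫ ∷ Γ} i)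
      (⊢-subst σ d) (⊢-subst σ d′)
  ⊢-subst σ (∀-neg {Γ} R 𝒰 A t R∉𝒰 i d) =
    ∀-neg R 𝒰 (subF (liftS σ) A) (subT σ t) R∉𝒰 (intuitionistic-subΓ σ {R ⟪ ∀[ 𝒰 ] A ⟫ ∷ Γ} i)
      (subst (λ B → ⊢ R ⟪ B ⟫ ∷ subΓ σ Γ) (subF-[] σ t A) (⊢-subst σ d))
  ⊢-subst σ (∀-pos {Γ} R 𝒰 A R∈𝒰 i d) =
    ∀-pos R 𝒰 (subF (liftS σ) A) R∈𝒰 (intuitionistic-subΓ σ {R ⟪ ∀[ 𝒰 ] A ⟫ ∷ Γ} i)
      (subst (λ Δ → ⊢ R ⟪ subF (liftS σ) A ⟫ ∷ Δ) (subΓ-shiftΓ σ Γ) (⊢-subst (liftS σ) d))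
  ⊢-subst σ (⊃-neg {Γ} R f 𝒰 A B R∉𝒰 i d) =
    ⊃-neg R f 𝒰 (subF σ A) (subF σ B) R∉𝒰 (intuitionistic-subΓ σ {R ⟪ A ⊃[ f , 𝒰 ] B ⟫ ∷ Γ} i)
      (⊢-subst σ d)
  ⊢-subst σ (⊃-pos {Γ₁} {Γ₂} R f 𝒰 A B R∈𝒰 i d d′) =
    subst (λ Δ → ⊢ R ⟪ subF σ (A ⊃[ f , 𝒰 ] B) ⟫ ∷ Δ) (sym (List.map-++ (subI σ) Γ₁ Γ₂))
      (⊃-pos R f 𝒰 (subF σ A) (subF σ B) R∈𝒰
        (subst (λ Δ → Intuitionistic (R ⟪ subF σ (A ⊃[ f , 𝒰 ] B) ⟫ ∷ Δ)) (List.map-++ (subI σ) Γ₁ Γ₂)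
          (intuitionistic-subΓ σ {R ⟪ A ⊃[ f , 𝒰 ] B ⟫ ∷ Γ₁ ++ Γ₂} i))
        (⊢-subst σ d) (⊢-subst σ d′))

  shiftΓ-subΓ : ∀ Γ → shiftΓ Γ ≡ subΓ (var ∘ suc) Γ
  shiftΓ-subΓ [] = refl
  shiftΓ-subΓ (X ∷ Γ) = cong₂ _∷_ (cong (role X ⟪_⟫) (renF-subF suc (form X))) (shiftΓ-subΓ Γ)

  ⊢-[] : ∀ t {R A Γ} → ⊢ R ⟪ A ⟫ ∷ shiftΓ Γ → ⊢ R ⟪ A [ t ] ⟫ ∷ Γ
  ⊢-[] t {R} {A} {Γ} d = subst (λ Δ → ⊢ R ⟪ A [ t ] ⟫ ∷ Δ) (subΓ-inst-shiftΓ Γ) (⊢-subst (inst t) d)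
    where
      subΓ-inst-shiftΓ : ∀ Γ → subΓ (inst t) (shiftΓ Γ) ≡ Γ
      subΓ-inst-shiftΓ [] = refl
      subΓ-inst-shiftΓ (X ∷ Γ) =
        cong₂ _∷_ (cong (role X ⟪_⟫) (renF-suc-[] t (form X))) (subΓ-inst-shiftΓ Γ)

  role-∈-𝒥 : ∀ {X S A} → X ≈ᵢ S ⟪ A ⟫ → S ∈ 𝒥 → role X ∈ 𝒥
  role-∈-𝒥 (lift X≐S , _) S∈𝒥 = ∈-resp-≐ 𝒥 (≐-sym X≐S) S∈𝒥

  ⊬𝒥-twice : ∀ {X Γ} → role X ∈ 𝒥 → ¬ (⊢ X ∷ X ∷ Γ)
  ⊬𝒥-twice X∈𝒥 d = All.head (proj₁ (⊢⇒intuitionistic d) X∈𝒥) X∈𝒥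

  AtomsOf : Pred → List (Term Fun) → Sequent → Set₁
  AtomsOf p ts = All (λ X → form X ≡ atom p ts)

  atoms-map : ∀ p ts Rs → AtomsOf p ts (map (_⟪ atom p ts ⟫) Rs)
  atoms-map p ts [] = []
  atoms-map p ts (R ∷ Rs) = refl ∷ atoms-map p ts Rs

  roles-map : ∀ p ts (Rs : List (RoleSet Ω)) → map role (map (_⟪ atom p ts ⟫) Rs) ≡ Rs
  roles-map p ts Rs = ≡.trans (sym (List.map-∘ Rs)) (List.map-id Rs)

  ⊢-Id : ∀ {p ts} Θ → AtomsOf p ts Θ → Partition (map role Θ) → Intuitionistic Θ → ⊢ Θ
  ⊢-Id {p} {ts} Θ atoms partition i =
    subst ⊢_ (atoms-eq Θ atoms)
      (Id p ts (map role Θ) (Partition⇒IsPartition partition)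
          (subst Intuitionistic (sym (atoms-eq Θ atoms)) i))
    where
      atoms-eq : ∀ Θ → AtomsOf p ts Θ → map (_⟪ atom p ts ⟫) (map role Θ) ≡ Θ
      atoms-eq [] [] = refl
      atoms-eq ((R ⟪ _ ⟫) ∷ Θ) (refl ∷ atoms) = cong (R ⟪ atom p ts ⟫ ∷_) (atoms-eq Θ atoms)


module CutAdmissibility (Ω Fun Pred : Set) (𝒥 : Ultrafilter Ω) where
  open MRLJ Ω Fun Pred hiding (⊢_; Intuitionistic)
  open Formulas Ω Fun Pred
  open Derivations Ω Fun Pred 𝒥
  open ↭-Solver {A = IFormula} using (solve; _⊜_; _⊕_)

  Copies : RoleSet Ω → Formula → Sequent → Set₁
  Copies S A = All (_≈ᵢ S ⟪ A ⟫)

  -- Principal S A Γ: a derivation of S{A}, Γ whose last rule introduces S{A}, given by its premisses.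
  data Principal : RoleSet Ω → Formula → Sequent → Set₁ where
    byId : ∀ {S p ts Γ} → Partition (S ∷ map role Γ) → AtomsOf p ts Γ → Principal S (atom p ts) Γ
    by¬ : ∀ {S f A Γ} → ⊢ preimage f S ⟪ A ⟫ ∷ Γ → Principal S (¬[ f ] A) Γ
    by∧-neg-l : ∀ {S 𝒰 A B Γ} → S ∉ 𝒰 → ⊢ S ⟪ A ⟫ ∷ Γ → Principal S (A ∧[ 𝒰 ] B) Γ
    by∧-neg-r : ∀ {S 𝒰 A B Γ} → S ∉ 𝒰 → ⊢ S ⟪ B ⟫ ∷ Γ → Principal S (A ∧[ 𝒰 ] B) Γ
    by∧-pos : ∀ {S 𝒰 A B Γ} → S ∈ 𝒰 → ⊢ S ⟪ A ⟫ ∷ Γ → ⊢ S ⟪ B ⟫ ∷ Γ → Principal S (A ∧[ 𝒰 ] B) Γ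
    by∀-neg : ∀ {S 𝒰 A Γ} → S ∉ 𝒰 → (t : Term Fun) → ⊢ S ⟪ A [ t ] ⟫ ∷ Γ → Principal S (∀[ 𝒰 ] A) Γ
    by∀-pos : ∀ {S 𝒰 A Γ} → S ∈ 𝒰 → ⊢ S ⟪ A ⟫ ∷ shiftΓ Γ → Principal S (∀[ 𝒰 ] A) Γ
    by⊃-neg : ∀ {S f 𝒰 A B Γ} → S ∉ 𝒰 → ⊢ preimage f S ⟪ A ⟫ ∷ S ⟪ B ⟫ ∷ Γ →
              Principal S (A ⊃[ f , 𝒰 ] B) Γ
    by⊃-pos : ∀ {S f 𝒰 A B Γ₁ Γ₂} → S ∈ 𝒰 → ⊢ preimage f S ⟪ A ⟫ ∷ Γ₁ → ⊢ S ⟪ B ⟫ ∷ Γ₂ →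
              Principal S (A ⊃[ f , 𝒰 ] B) (Γ₁ ++ Γ₂)

  σ↑ : ℕ → Term Fun
  σ↑ = var ∘ suc

  Principal-subst : ∀ σ {S A Γ} → Principal S A Γ → Principal S (subF σ A) (subΓ σ Γ)
  Principal-subst σ {S} {Γ = Γ} (byId partition atoms) =
    byId (subst (λ Rs → Partition (S ∷ Rs)) (List.map-∘ Γ) partition) (atoms-subΓ atoms)
    where
      atoms-subΓ : ∀ {p ts Γ} → AtomsOf p ts Γ → AtomsOf p (subTs σ ts) (subΓ σ Γ)
      atoms-subΓ [] = []
      atoms-subΓ (eq ∷ eqs) = cong (subF σ) eq ∷ atoms-subΓ eqs
  Principal-subst σ (by¬ d) = by¬ (⊢-subst σ d)
  Principal-subst σ (by∧-neg-l S∉𝒰 d) = by∧-neg-l S∉𝒰 (⊢-subst σ d)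
  Principal-subst σ (by∧-neg-r S∉𝒰 d) = by∧-neg-r S∉𝒰 (⊢-subst σ d)
  Principal-subst σ (by∧-pos S∈𝒰 d d′) = by∧-pos S∈𝒰 (⊢-subst σ d) (⊢-subst σ d′)
  Principal-subst σ {S} {Γ = Γ} (by∀-neg {A = A} S∉𝒰 t d) =
    by∀-neg S∉𝒰 (subT σ t) (subst (λ B → ⊢ S ⟪ B ⟫ ∷ subΓ σ Γ) (subF-[] σ t A) (⊢-subst σ d))
  Principal-subst σ {S} {Γ = Γ} (by∀-pos {A = A} S∈𝒰 d) =
    by∀-pos S∈𝒰 (subst (λ Δ → ⊢ S ⟪ subF (liftS σ) A ⟫ ∷ Δ) (subΓ-shiftΓ σ Γ) (⊢-subst (liftS σ) d))
  Principal-subst σ (by⊃-neg S∉𝒰 d) = by⊃-neg S∉𝒰 (⊢-subst σ d)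
  Principal-subst σ {S} (by⊃-pos {f = f} {𝒰} {A} {B} {Γ₁} {Γ₂} S∈𝒰 d d′) =
    subst (Principal S (subF σ (A ⊃[ f , 𝒰 ] B))) (sym (List.map-++ (subI σ) Γ₁ Γ₂))
      (by⊃-pos S∈𝒰 (⊢-subst σ d) (⊢-subst σ d′))

  copies-resp-≋ : ∀ {S A Xs Ys} → Xs ≋ Ys → Copies S A Ys → Copies S A Xs
  copies-resp-≋ [] [] = []
  copies-resp-≋ (X≈Y ∷ Xs≋Ys) (Y≈ ∷ Ys≈) = ≈ᵢ-trans X≈Y Y≈ ∷ copies-resp-≋ Xs≋Ys Ys≈

  copies-resp-≅ : ∀ {S A B Ys} → A ≅ B → Copies S A Ys → Copies S B Ys
  copies-resp-≅ A≅B = All.map λ Y≈ → ≈ᵢ-trans Y≈ (lift ≐-refl , A≅B)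

  copies-subΓ : ∀ σ {S A Ys} → Copies S A Ys → Copies S (subF σ A) (subΓ σ Ys)
  copies-subΓ σ [] = []
  copies-subΓ σ ((R≐S , B≅A) ∷ Ys≈) = (R≐S , ≅-subF σ B≅A) ∷ copies-subΓ σ Ys≈

  data Occurrence (H : IFormula) (Θ : Sequent) (S : RoleSet Ω) (A : Formula) (Ys Δ : Sequent) :
                  Set₁ where
    copy : ∀ {Ys′} → H ≈ᵢ S ⟪ A ⟫ → Copies S A Ys′ → Θ ↭ Ys′ ++ Δ → Occurrence H Θ S A Ys Δ
    side : ∀ {Δ′} → Δ ↭ H ∷ Δ′ → Θ ↭ Ys ++ Δ′ → Occurrence H Θ S A Ys Δ

  occurrence : ∀ {H Θ S A} Ys {Δ} → H ∷ Θ ↭ Ys ++ Δ → Copies S A Ys → Occurrence H Θ S A Ys Δ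
  occurrence Ys pr Ys≈ with ∷-↭-++-cases Ys pr
  ... | inj₁ (Ys′ , q , q′) with ↭.All-resp-↭ q Ys≈
  ...   | H≈ ∷ Ys′≈ = copy H≈ Ys′≈ q′
  occurrence Ys pr Ys≈ | inj₂ (Δ′ , q , q′) = side q q′

  𝒥-free-beside : ∀ {Θ X Γ S A} → ⊢ Θ → Θ ↭ X ∷ Γ → X ≈ᵢ S ⟪ A ⟫ → S ∈ 𝒥 → 𝒥-Free Γ
  𝒥-free-beside d p (lift X≐S , _) S∈𝒥 =
    proj₁ (intuitionistic-resp-↭ p (⊢⇒intuitionistic d)) (∈-resp-≐ 𝒥 (≐-sym X≐S) S∈𝒥)

  intuitionistic-beside : ∀ {Θ} Ys {Δ} → ⊢ Θ → Θ ↭ Ys ++ Δ → Intuitionistic Δ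
  intuitionistic-beside Ys d p = intuitionistic-++⁻ʳ Ys (intuitionistic-resp-↭ p (⊢⇒intuitionistic d))

  ⊢-to-front : ∀ Γ {X Δ} → ⊢ Γ ++ X ∷ Δ → ⊢ X ∷ Γ ++ Δ
  ⊢-to-front Γ {X} {Δ} = exch (↭.shift X Γ Δ)

  ⊢-via-↭ : ∀ {Θ Γ Δ} → Θ ↭ Γ ++ Δ → 𝒥-Free Γ → Intuitionistic Δ →
            (Intuitionistic Θ → ⊢ Θ) → ⊢ Γ ++ Δ
  ⊢-via-↭ π Γ∉𝒥 iΔ rule =
    exch π (rule (intuitionistic-resp-↭ (↭-sym π) (intuitionistic-++ Γ∉𝒥 iΔ)))

  commuteˡ : ∀ Φ {H Γ Γ′ Δ} → 𝒥-Free Γ → Intuitionistic Δ → Γ ↭ H ∷ Γ′ →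
             (Intuitionistic (H ∷ Γ′ ++ Δ) → ⊢ Φ ++ Γ′ ++ Δ → ⊢ H ∷ Γ′ ++ Δ) →
             ⊢ (Φ ++ Γ′) ++ Δ → ⊢ Γ ++ Δ
  commuteˡ Φ {Γ′ = Γ′} {Δ} Γ∉𝒥 iΔ Γ↭ rule d =
    ⊢-via-↭ (↭.++⁺ʳ Δ (↭-sym Γ↭)) Γ∉𝒥 iΔ (λ i → rule i (subst ⊢_ (List.++-assoc Φ Γ′ Δ) d))

  commuteʳ : ∀ Φ {H Γ Δ Δ′} → 𝒥-Free Γ → Intuitionistic Δ → Δ ↭ H ∷ Δ′ →
             (Intuitionistic (H ∷ Γ ++ Δ′) → ⊢ Φ ++ Γ ++ Δ′ → ⊢ H ∷ Γ ++ Δ′) →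
             ⊢ Γ ++ Φ ++ Δ′ → ⊢ Γ ++ Δ
  commuteʳ Φ {Γ = Γ} Γ∉𝒥 iΔ Δ↭ rule d =
    ⊢-via-↭ (insert-↭ Γ Δ↭) Γ∉𝒥 iΔ (λ i → rule i (exch (↭.shifts Γ Φ) d))

  shiftΓ-++ : ∀ Γ Δ → subΓ σ↑ Γ ++ subΓ σ↑ Δ ≡ shiftΓ (Γ ++ Δ)
  shiftΓ-++ Γ Δ = ≡.trans (sym (List.map-++ (subI σ↑) Γ Δ)) (sym (shiftΓ-subΓ (Γ ++ Δ)))

  ⊢-unshift : ∀ {X} Γ Δ → ⊢ subΓ σ↑ Γ ++ X ∷ subΓ σ↑ Δ → ⊢ X ∷ shiftΓ (Γ ++ Δ)
  ⊢-unshift {X} Γ Δ d = subst (λ Θ → ⊢ X ∷ Θ) (shiftΓ-++ Γ Δ) (⊢-to-front (subΓ σ↑ Γ) d)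

  ↭-subΓ-++ : ∀ σ {Θ} Ys {Δ} → Θ ↭ Ys ++ Δ → subΓ σ Θ ↭ subΓ σ Ys ++ subΓ σ Δ
  ↭-subΓ-++ σ Ys {Δ} p = ↭-trans (↭.map⁺ (subI σ) p) (↭-reflexive (List.map-++ (subI σ) Ys Δ))

  complementary-≐ʳ : ∀ {S S′ T : RoleSet Ω} → Complementary S S′ → T ≐ S′ → Complementary S T
  complementary-≐ʳ c T≐S′ = complementary-resp-≐ ≐-refl (≐-sym T≐S′) c

  complementary-preimage : ∀ {S S′ T : RoleSet Ω} {f g} → Complementary S S′ → T ≐ S′ →
                           (∀ r → g r ≡ f r) → Complementary (preimage f S) (preimage g T)
  complementary-preimage {T = T} {f} c T≐S′ g≗f =
    complementary-resp-≐ ≐-refl (preimage-cong {R = T} (λ r → sym (g≗f r)) ≐-refl)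
      (preimage-complementary f (complementary-≐ʳ c T≐S′))

  principal-atom : ∀ {p ts Rs X Γ} → IsPartition Rs → map (_⟪ atom p ts ⟫) Rs ↭ X ∷ Γ →
                   Principal (role X) (form X) Γ
  principal-atom {p} {ts} {Rs} {X} {Γ} partition pe =
    subst (λ A → Principal (role X) A Γ) (sym (All.head atoms))
      (byId (partition-resp-↭ (↭-trans (↭-reflexive (sym (roles-map p ts Rs))) (↭.map⁺ role pe))
                              (IsPartition⇒Partition partition))
            (All.tail atoms))
    where atoms = ↭.All-resp-↭ pe (atoms-map p ts Rs)

  axiom-cut : ∀ {S S′ A Γ Δ p ts Qs Y Ys} → Complementary S S′ → 𝒥-Free Γ → Intuitionistic Δ →
              Principal S A Γ → IsPartition Qs → map (_⟪ atom p ts ⟫) Qs ↭ (Y ∷ Ys) ++ Δ →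
              Copies S′ A (Y ∷ Ys) → ⊢ Γ ++ Δ
  axiom-cut {S} {Γ = Γ} {Δ} {p} {ts} {Qs} {Y} {Ys} c Γ∉𝒥 iΔ principal partition pr Ys≈ =
    go (subst (_≅ _) (All.head atomsʳ) (proj₂ (All.head Ys≈))) principal
    where
      atomsʳ = ↭.All-resp-↭ pr (atoms-map p ts Qs)
      rolesʳ : All (_≐ _) (map role (Y ∷ Ys))
      rolesʳ = All.map⁺ (All.map (lower ∘ proj₁) Ys≈)
      partitionʳ : Partition (map role (Y ∷ Ys) ++ map role Δ)
      partitionʳ = subst Partition (List.map-++ role (Y ∷ Ys) Δ)
        (partition-resp-↭ (↭-trans (↭-reflexive (sym (roles-map p ts Qs))) (↭.map⁺ role pr))
                          (IsPartition⇒Partition partition))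
      go : ∀ {A} → atom p ts ≅ A → Principal S A Γ → ⊢ Γ ++ Δ
      go atom≅ (byId partitionˡ atomsˡ) =
        ⊢-Id (Γ ++ Δ) (All.++⁺ atomsˡ (All.++⁻ʳ (Y ∷ Ys) atomsʳ))
          (subst Partition (sym (List.map-++ role Γ Δ)) (partition-cut c rolesʳ partitionˡ partitionʳ))
          (intuitionistic-++ Γ∉𝒥 iΔ)

  ¬both-∉ : ∀ {S S′ T 𝒰 𝒱} → Complementary S S′ → T ≐ S′ → 𝒰 ≈ᵤ 𝒱 → T ∉ 𝒰 → S ∉ 𝒱 → ⊥
  ¬both-∉ {𝒱 = 𝒱} c T≐S′ 𝒰≈𝒱 T∉𝒰 S∉𝒱 =
    complementary-∉ 𝒱 (complementary-≐ʳ c T≐S′) S∉𝒱 (∉-resp-≈ᵤ 𝒰≈𝒱 ≐-refl T∉𝒰)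

  weakenʳ* : ∀ {Γ} Δ → Intuitionistic (Γ ++ Δ) → ⊢ Γ → ⊢ Γ ++ Δ
  weakenʳ* {Γ} Δ i d = exch (↭.++-comm Δ Γ) (weaken* Δ (intuitionistic-resp-↭ (↭.++-comm Γ Δ) i) d)

  mutual
    cut : ∀ s {T T′ C C′ Γ₁ Γ₂} → Complementary T T′ → HasShape C s → C′ ≅ C →
          ⊢ T ⟪ C ⟫ ∷ Γ₁ → ⊢ T′ ⟪ C′ ⟫ ∷ Γ₂ → ⊢ Γ₁ ++ Γ₂
    cut s {T} {T′} {C} {C′} {Γ₁} {Γ₂} c sh C′≅C d d′ with complementary-∈ 𝒥 c
    ... | inj₁ T∈𝒥 =
      cutˡ s c T∈𝒥 sh d ↭-refl ≈ᵢ-refl {Ys = T′ ⟪ C′ ⟫ ∷ []} d′ ↭-refl ((lift ≐-refl , C′≅C) ∷ [])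
    ... | inj₂ T′∈𝒥 =
      exch (↭.++-comm Γ₂ Γ₁)
        (cutˡ s (complementary-sym c) T′∈𝒥 (HasShape-resp-≅ (≅-sym C′≅C) sh) d′ ↭-refl ≈ᵢ-refl
              {Ys = T ⟪ C ⟫ ∷ []} d ↭-refl ((lift ≐-refl , ≅-sym C′≅C) ∷ []))

    cutˡ : ∀ s {S S′ A} → Complementary S S′ → S ∈ 𝒥 → HasShape A s →
           ∀ {Θ X Γ} → ⊢ Θ → Θ ↭ X ∷ Γ → X ≈ᵢ S ⟪ A ⟫ →
           ∀ {Θ′ Ys Δ} → ⊢ Θ′ → Θ′ ↭ Ys ++ Δ → Copies S′ A Ys → ⊢ Γ ++ Δ
    cutˡ s c S∈𝒥 sh (exch q L) pe X≈ R pr Ys≈ = cutˡ s c S∈𝒥 sh L (↭-trans q pe) X≈ R pr Ys≈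
    cutˡ s c S∈𝒥 sh (ext w L) pe X≈ R pr Ys≈ with Pointwise-↭ (≈I⇒≋ w) pe
    ... | _ , q , (X′≈X ∷ Γ′≋Γ) =
      ⊢-resp-≋ (Pointwise.++⁺ Γ′≋Γ ≋-refl) (cutˡ s c S∈𝒥 sh L q (≈ᵢ-trans X′≈X X≈) R pr Ys≈)
    cutˡ s c S∈𝒥 sh L@(Id _ _ _ partition _) pe X≈ R pr Ys≈ =
      cutˡ-principal s c S∈𝒥 sh (exch pe L) ↭-refl X≈ (principal-atom partition pe) R pr Ys≈
    cutˡ s c S∈𝒥 sh L@(Weaken _ _ _ L₁) pe X≈ {Ys = Ys} {Δ} R pr Ys≈
      with ∷-↭-∷-cases pe | 𝒥-free-beside L pe X≈ S∈𝒥 | intuitionistic-beside Ys R pr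
    ... | inj₁ (refl , q) | Γ∉𝒥 | iΔ = weakenʳ* Δ (intuitionistic-++ Γ∉𝒥 iΔ) (exch q L₁)
    ... | inj₂ (_ , q , q′) | Γ∉𝒥 | iΔ =
      commuteˡ [] Γ∉𝒥 iΔ q′ (Weaken _ _) (cutˡ s c S∈𝒥 sh L₁ q X≈ R pr Ys≈)
    cutˡ s c S∈𝒥 sh L@(Contract _ _ _ L₁) pe X≈ {Ys = Ys} R pr Ys≈
      with ∷-↭-∷-cases pe | 𝒥-free-beside L pe X≈ S∈𝒥 | intuitionistic-beside Ys R pr
    ... | inj₁ (refl , _) | _ | _ = ⊥-elim (⊬𝒥-twice (role-∈-𝒥 X≈ S∈𝒥) L₁)
    ... | inj₂ (_ , q , q′) | Γ∉𝒥 | iΔ =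
      commuteˡ (_ ∷ _ ∷ []) Γ∉𝒥 iΔ q′ (Contract _ _)
        (cutˡ s c S∈𝒥 sh L₁ (prepend-↭-∷ (_ ∷ _ ∷ []) q) X≈ R pr Ys≈)
    cutˡ s c S∈𝒥 sh L@(Neg T f B _ L₁) pe X≈ {Ys = Ys} R pr Ys≈
      with ∷-↭-∷-cases pe | 𝒥-free-beside L pe X≈ S∈𝒥 | intuitionistic-beside Ys R pr
    ... | inj₁ (refl , q) | _ | _ = cutˡ-principal s c S∈𝒥 sh L q X≈ (by¬ L₁) R pr Ys≈
    ... | inj₂ (_ , q , q′) | Γ∉𝒥 | iΔ =
      commuteˡ (_ ∷ []) Γ∉𝒥 iΔ q′ (Neg T f B) (cutˡ s c S∈𝒥 sh L₁ (prepend-↭-∷ (_ ∷ []) q) X≈ R pr Ys≈)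
    cutˡ s c S∈𝒥 sh L@(∧-neg-l T 𝒰 B C T∉𝒰 _ L₁) pe X≈ {Ys = Ys} R pr Ys≈
      with ∷-↭-∷-cases pe | 𝒥-free-beside L pe X≈ S∈𝒥 | intuitionistic-beside Ys R pr
    ... | inj₁ (refl , q) | _ | _ = cutˡ-principal s c S∈𝒥 sh L q X≈ (by∧-neg-l T∉𝒰 L₁) R pr Ys≈
    ... | inj₂ (_ , q , q′) | Γ∉𝒥 | iΔ =
      commuteˡ (_ ∷ []) Γ∉𝒥 iΔ q′ (∧-neg-l T 𝒰 B C T∉𝒰)
        (cutˡ s c S∈𝒥 sh L₁ (prepend-↭-∷ (_ ∷ []) q) X≈ R pr Ys≈)
    cutˡ s c S∈𝒥 sh L@(∧-neg-r T 𝒰 B C T∉𝒰 _ L₁) pe X≈ {Ys = Ys} R pr Ys≈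
      with ∷-↭-∷-cases pe | 𝒥-free-beside L pe X≈ S∈𝒥 | intuitionistic-beside Ys R pr
    ... | inj₁ (refl , q) | _ | _ = cutˡ-principal s c S∈𝒥 sh L q X≈ (by∧-neg-r T∉𝒰 L₁) R pr Ys≈
    ... | inj₂ (_ , q , q′) | Γ∉𝒥 | iΔ =
      commuteˡ (_ ∷ []) Γ∉𝒥 iΔ q′ (∧-neg-r T 𝒰 B C T∉𝒰)
        (cutˡ s c S∈𝒥 sh L₁ (prepend-↭-∷ (_ ∷ []) q) X≈ R pr Ys≈)
    cutˡ s c S∈𝒥 sh L@(∧-pos T 𝒰 B C T∈𝒰 _ L₁ L₂) pe X≈ {Ys = Ys} R pr Ys≈
      with ∷-↭-∷-cases pe | 𝒥-free-beside L pe X≈ S∈𝒥 | intuitionistic-beside Ys R pr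
    ... | inj₁ (refl , q) | _ | _ = cutˡ-principal s c S∈𝒥 sh L q X≈ (by∧-pos T∈𝒰 L₁ L₂) R pr Ys≈
    ... | inj₂ (_ , q , q′) | Γ∉𝒥 | iΔ =
      commuteˡ (_ ∷ []) Γ∉𝒥 iΔ q′
        (λ i d → ∧-pos T 𝒰 B C T∈𝒰 i d (cutˡ s c S∈𝒥 sh L₂ (prepend-↭-∷ (_ ∷ []) q) X≈ R pr Ys≈))
        (cutˡ s c S∈𝒥 sh L₁ (prepend-↭-∷ (_ ∷ []) q) X≈ R pr Ys≈)
    cutˡ s c S∈𝒥 sh L@(∀-neg T 𝒰 B t T∉𝒰 _ L₁) pe X≈ {Ys = Ys} R pr Ys≈
      with ∷-↭-∷-cases pe | 𝒥-free-beside L pe X≈ S∈𝒥 | intuitionistic-beside Ys R pr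
    ... | inj₁ (refl , q) | _ | _ = cutˡ-principal s c S∈𝒥 sh L q X≈ (by∀-neg T∉𝒰 t L₁) R pr Ys≈
    ... | inj₂ (_ , q , q′) | Γ∉𝒥 | iΔ =
      commuteˡ (_ ∷ []) Γ∉𝒥 iΔ q′ (∀-neg T 𝒰 B t T∉𝒰)
        (cutˡ s c S∈𝒥 sh L₁ (prepend-↭-∷ (_ ∷ []) q) X≈ R pr Ys≈)
    cutˡ s c S∈𝒥 sh L@(∀-pos T 𝒰 B T∈𝒰 _ L₁) pe X≈ {Ys = Ys} {Δ} R pr Ys≈
      with ∷-↭-∷-cases pe | 𝒥-free-beside L pe X≈ S∈𝒥 | intuitionistic-beside Ys R pr
    ... | inj₁ (refl , q) | _ | _ = cutˡ-principal s c S∈𝒥 sh L q X≈ (by∀-pos T∈𝒰 L₁) R pr Ys≈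
    ... | inj₂ (_ , q , q′) | Γ∉𝒥 | iΔ =
      ⊢-via-↭ (↭.++⁺ʳ Δ (↭-sym q′)) Γ∉𝒥 iΔ
        (λ i → ∀-pos T 𝒰 B T∈𝒰 i (cutˡ-under-∀ s c S∈𝒥 sh L₁ q X≈ R pr Ys≈))
    cutˡ s c S∈𝒥 sh L@(⊃-neg T f 𝒰 B C T∉𝒰 _ L₁) pe X≈ {Ys = Ys} R pr Ys≈
      with ∷-↭-∷-cases pe | 𝒥-free-beside L pe X≈ S∈𝒥 | intuitionistic-beside Ys R pr
    ... | inj₁ (refl , q) | _ | _ = cutˡ-principal s c S∈𝒥 sh L q X≈ (by⊃-neg T∉𝒰 L₁) R pr Ys≈
    ... | inj₂ (_ , q , q′) | Γ∉𝒥 | iΔ =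
      commuteˡ (_ ∷ _ ∷ []) Γ∉𝒥 iΔ q′ (⊃-neg T f 𝒰 B C T∉𝒰)
        (cutˡ s c S∈𝒥 sh L₁ (prepend-↭-∷ (_ ∷ _ ∷ []) q) X≈ R pr Ys≈)
    cutˡ s c S∈𝒥 sh L@(⊃-pos {Γ₁} {Γ₂} T f 𝒰 B C T∈𝒰 _ L₁ L₂) pe X≈ {Ys = Ys} {Δ} R pr Ys≈
      with ∷-↭-∷-cases pe | 𝒥-free-beside L pe X≈ S∈𝒥 | intuitionistic-beside Ys R pr
    ... | inj₁ (refl , q) | _ | _ = cutˡ-principal s c S∈𝒥 sh L q X≈ (by⊃-pos T∈𝒰 L₁ L₂) R pr Ys≈
    ... | inj₂ (Γ′ , q , q′) | Γ∉𝒥 | iΔ with ∈-++⁻ Γ₁ (↭.∈-resp-↭ (↭-sym q) (here refl))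
    ...   | inj₁ X∈Γ₁ with ∈⇒↭∷ X∈Γ₁
    ...     | Γ₁′ , r =
      ⊢-via-↭ π Γ∉𝒥 iΔ
        (λ i → ⊃-pos T f 𝒰 B C T∈𝒰 i (cutˡ s c S∈𝒥 sh L₁ (prepend-↭-∷ (_ ∷ []) r) X≈ R pr Ys≈) L₂)
      where
        π : _ ∷ (Γ₁′ ++ Δ) ++ Γ₂ ↭ _ ++ Δ
        π = ↭-trans (prep _ (↭-trans (solve 3 (λ a d b → (a ⊕ d) ⊕ b ⊜ (a ⊕ b) ⊕ d) ↭-refl Γ₁′ Δ Γ₂)
                                     (↭.++⁺ʳ Δ (↭.drop-∷ (↭-trans (↭.++⁺ʳ Γ₂ (↭-sym r)) q)))))
                    (↭.++⁺ʳ Δ (↭-sym q′))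
    cutˡ s c S∈𝒥 sh L@(⊃-pos {Γ₁} {Γ₂} T f 𝒰 B C T∈𝒰 _ L₁ L₂) pe X≈ {Ys = Ys} {Δ} R pr Ys≈
      | inj₂ (Γ′ , q , q′) | Γ∉𝒥 | iΔ | inj₂ X∈Γ₂ with ∈⇒↭∷ X∈Γ₂
    ...     | Γ₂′ , r =
      ⊢-via-↭ π Γ∉𝒥 iΔ
        (λ i → ⊃-pos T f 𝒰 B C T∈𝒰 i L₁ (cutˡ s c S∈𝒥 sh L₂ (prepend-↭-∷ (_ ∷ []) r) X≈ R pr Ys≈))
      where
        π : _ ∷ Γ₁ ++ Γ₂′ ++ Δ ↭ _ ++ Δ
        π = ↭-trans (prep _ (↭-trans (↭-reflexive (sym (List.++-assoc Γ₁ Γ₂′ Δ)))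
                                     (↭.++⁺ʳ Δ (↭.drop-∷ (↭-trans (insert-↭ Γ₁ r) q)))))
                    (↭.++⁺ʳ Δ (↭-sym q′))

    cutˡ-principal : ∀ s {S S′ A} → Complementary S S′ → S ∈ 𝒥 → HasShape A s →
                     ∀ {X Θ Γ} → ⊢ X ∷ Θ → Θ ↭ Γ → X ≈ᵢ S ⟪ A ⟫ → Principal (role X) (form X) Θ →
                     ∀ {Θ′ Ys Δ} → ⊢ Θ′ → Θ′ ↭ Ys ++ Δ → Copies S′ A Ys → ⊢ Γ ++ Δ
    cutˡ-principal s c S∈𝒥 sh L q X≈@(lift X≐S , B≅A) principal R pr Ys≈ =
      exch (↭.++⁺ʳ _ q)
        (cutʳ s (complementary-resp-≐ (≐-sym X≐S) ≐-refl c) (HasShape-resp-≅ (≅-sym B≅A) sh)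
              (𝒥-free-beside L ↭-refl X≈ S∈𝒥) principal R pr (copies-resp-≅ (≅-sym B≅A) Ys≈))

    cutˡ-under-∀ : ∀ s {S S′ A} → Complementary S S′ → S ∈ 𝒥 → HasShape A s →
                   ∀ {Y Θ X Γ′} → ⊢ Y ∷ shiftΓ Θ → Θ ↭ X ∷ Γ′ → X ≈ᵢ S ⟪ A ⟫ →
                   ∀ {Θ′ Ys Δ} → ⊢ Θ′ → Θ′ ↭ Ys ++ Δ → Copies S′ A Ys → ⊢ Y ∷ shiftΓ (Γ′ ++ Δ)
    cutˡ-under-∀ s c S∈𝒥 sh {Θ = Θ} {Γ′ = Γ′} L q (X≐S , B≅A) {Ys = Ys} {Δ} R pr Ys≈ =
      subst (λ Ψ → ⊢ _ ∷ Ψ) (shiftΓ-++ Γ′ Δ)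
        (cutˡ s c S∈𝒥 (HasShape-subF σ↑ sh) L
          (↭-trans (↭-reflexive (cong (_ ∷_) (shiftΓ-subΓ Θ)))
                   (prepend-↭-∷ (_ ∷ []) (↭.map⁺ (subI σ↑) q)))
          (X≐S , ≅-subF σ↑ B≅A) (⊢-subst σ↑ R) (↭-subΓ-++ σ↑ Ys pr) (copies-subΓ σ↑ Ys≈))

    cutʳ : ∀ s {S S′ A Γ} → Complementary S S′ → HasShape A s → 𝒥-Free Γ → Principal S A Γ →
           ∀ {Θ Ys Δ} → ⊢ Θ → Θ ↭ Ys ++ Δ → Copies S′ A Ys → ⊢ Γ ++ Δ
    cutʳ s c sh Γ∉𝒥 P {Ys = []} R pr [] =
      weaken* _ (intuitionistic-++ Γ∉𝒥 (intuitionistic-beside [] R pr)) (exch pr R)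
    cutʳ s c sh Γ∉𝒥 P (exch q R) pr Ys≈ = cutʳ s c sh Γ∉𝒥 P R (↭-trans q pr) Ys≈
    cutʳ s c sh Γ∉𝒥 P {Ys = Ys} (ext w R) pr Ys≈ with Pointwise-↭ (≈I⇒≋ w) pr
    ... | _ , q , Θ≋ with Pointwise-++ʳ-split Ys Θ≋
    ...   | _ , _ , refl , Ys′≋Ys , Δ′≋Δ =
      ⊢-resp-≋ (Pointwise.++⁺ ≋-refl Δ′≋Δ) (cutʳ s c sh Γ∉𝒥 P R q (copies-resp-≋ Ys′≋Ys Ys≈))
    cutʳ s c sh Γ∉𝒥 P {Ys = Y ∷ Ys} R@(Id _ _ _ partition _) pr Ys≈ =
      axiom-cut c Γ∉𝒥 (intuitionistic-beside (Y ∷ Ys) R pr) P partition pr Ys≈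
    cutʳ s c sh Γ∉𝒥 P {Ys = Ys} R@(Weaken _ _ _ R₁) pr Ys≈
      with occurrence Ys pr Ys≈ | intuitionistic-beside Ys R pr
    ... | copy _ Ys′≈ q′ | _ = cutʳ s c sh Γ∉𝒥 P R₁ q′ Ys′≈
    ... | side q q′ | iΔ = commuteʳ [] Γ∉𝒥 iΔ q (Weaken _ _) (cutʳ s c sh Γ∉𝒥 P R₁ q′ Ys≈)
    cutʳ s c sh Γ∉𝒥 P {Ys = Ys} R@(Contract _ _ _ R₁) pr Ys≈
      with occurrence Ys pr Ys≈ | intuitionistic-beside Ys R pr
    ... | copy H≈ Ys′≈ q′ | _ = cutʳ s c sh Γ∉𝒥 P R₁ (prep _ (prep _ q′)) (H≈ ∷ H≈ ∷ Ys′≈)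
    ... | side q q′ | iΔ =
      commuteʳ (_ ∷ _ ∷ []) Γ∉𝒥 iΔ q (Contract _ _)
        (cutʳ s c sh Γ∉𝒥 P R₁ (prepend-↭-++ (_ ∷ _ ∷ []) Ys q′) Ys≈)
    cutʳ s c sh Γ∉𝒥 P {Ys = Ys} R@(Neg T g B _ R₁) pr Ys≈
      with occurrence Ys pr Ys≈ | intuitionistic-beside Ys R pr
    ... | copy (lift T≐S′ , ≅A) Ys′≈ q′ | _ =
      reduce-¬ ≅A s sh c T≐S′ P (cutʳ s c sh Γ∉𝒥 P R₁ (prepend-↭-++ (_ ∷ []) _ q′) Ys′≈)
    ... | side q q′ | iΔ =
      commuteʳ (_ ∷ []) Γ∉𝒥 iΔ q (Neg T g B) (cutʳ s c sh Γ∉𝒥 P R₁ (prepend-↭-++ (_ ∷ []) Ys q′) Ys≈)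
    cutʳ s c sh Γ∉𝒥 P {Ys = Ys} R@(∧-neg-l T 𝒰 B C T∉𝒰 _ R₁) pr Ys≈
      with occurrence Ys pr Ys≈ | intuitionistic-beside Ys R pr
    ... | copy (lift T≐S′ , ≅A) Ys′≈ q′ | _ =
      reduce-∧-neg-l ≅A s sh c T≐S′ T∉𝒰 P (cutʳ s c sh Γ∉𝒥 P R₁ (prepend-↭-++ (_ ∷ []) _ q′) Ys′≈)
    ... | side q q′ | iΔ =
      commuteʳ (_ ∷ []) Γ∉𝒥 iΔ q (∧-neg-l T 𝒰 B C T∉𝒰)
        (cutʳ s c sh Γ∉𝒥 P R₁ (prepend-↭-++ (_ ∷ []) Ys q′) Ys≈)
    cutʳ s c sh Γ∉𝒥 P {Ys = Ys} R@(∧-neg-r T 𝒰 B C T∉𝒰 _ R₁) pr Ys≈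
      with occurrence Ys pr Ys≈ | intuitionistic-beside Ys R pr
    ... | copy (lift T≐S′ , ≅A) Ys′≈ q′ | _ =
      reduce-∧-neg-r ≅A s sh c T≐S′ T∉𝒰 P (cutʳ s c sh Γ∉𝒥 P R₁ (prepend-↭-++ (_ ∷ []) _ q′) Ys′≈)
    ... | side q q′ | iΔ =
      commuteʳ (_ ∷ []) Γ∉𝒥 iΔ q (∧-neg-r T 𝒰 B C T∉𝒰)
        (cutʳ s c sh Γ∉𝒥 P R₁ (prepend-↭-++ (_ ∷ []) Ys q′) Ys≈)
    cutʳ s {Γ = Γ} c sh Γ∉𝒥 P {Ys = Ys} R@(∧-pos T 𝒰 B C T∈𝒰 _ R₁ R₂) pr Ys≈
      with occurrence Ys pr Ys≈ | intuitionistic-beside Ys R pr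
    ... | copy (lift T≐S′ , ≅A) Ys′≈ q′ | _ =
      reduce-∧-pos ≅A s sh c T≐S′ T∈𝒰 P
        (cutʳ s c sh Γ∉𝒥 P R₁ (prepend-↭-++ (_ ∷ []) _ q′) Ys′≈)
        (cutʳ s c sh Γ∉𝒥 P R₂ (prepend-↭-++ (_ ∷ []) _ q′) Ys′≈)
    ... | side q q′ | iΔ =
      commuteʳ (_ ∷ []) Γ∉𝒥 iΔ q
        (λ i d → ∧-pos T 𝒰 B C T∈𝒰 i d
                   (⊢-to-front Γ (cutʳ s c sh Γ∉𝒥 P R₂ (prepend-↭-++ (_ ∷ []) Ys q′) Ys≈)))
        (cutʳ s c sh Γ∉𝒥 P R₁ (prepend-↭-++ (_ ∷ []) Ys q′) Ys≈)
    cutʳ s c sh Γ∉𝒥 P {Ys = Ys} R@(∀-neg T 𝒰 B t T∉𝒰 _ R₁) pr Ys≈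
      with occurrence Ys pr Ys≈ | intuitionistic-beside Ys R pr
    ... | copy (lift T≐S′ , ≅A) Ys′≈ q′ | _ =
      reduce-∀-neg ≅A s sh c T≐S′ T∉𝒰 P (cutʳ s c sh Γ∉𝒥 P R₁ (prepend-↭-++ (_ ∷ []) _ q′) Ys′≈)
    ... | side q q′ | iΔ =
      commuteʳ (_ ∷ []) Γ∉𝒥 iΔ q (∀-neg T 𝒰 B t T∉𝒰)
        (cutʳ s c sh Γ∉𝒥 P R₁ (prepend-↭-++ (_ ∷ []) Ys q′) Ys≈)
    cutʳ s {Γ = Γ} c sh Γ∉𝒥 P {Ys = Ys} R@(∀-pos T 𝒰 B T∈𝒰 _ R₁) pr Ys≈
      with occurrence Ys pr Ys≈ | intuitionistic-beside Ys R pr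
    ... | copy (lift T≐S′ , ≅A) Ys′≈ q′ | _ =
      reduce-∀-pos ≅A s sh c T≐S′ T∈𝒰 P (cutʳ-under-∀ s c sh Γ∉𝒥 P R₁ q′ Ys′≈)
    ... | side q q′ | iΔ =
      ⊢-via-↭ (insert-↭ Γ q) Γ∉𝒥 iΔ (λ i → ∀-pos T 𝒰 B T∈𝒰 i (cutʳ-under-∀ s c sh Γ∉𝒥 P R₁ q′ Ys≈))
    cutʳ s c sh Γ∉𝒥 P {Ys = Ys} R@(⊃-neg T g 𝒰 B C T∉𝒰 _ R₁) pr Ys≈
      with occurrence Ys pr Ys≈ | intuitionistic-beside Ys R pr
    ... | copy (lift T≐S′ , ≅A) Ys′≈ q′ | _ =
      reduce-⊃-neg ≅A s sh c T≐S′ T∉𝒰 P (cutʳ s c sh Γ∉𝒥 P R₁ (prepend-↭-++ (_ ∷ _ ∷ []) _ q′) Ys′≈)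
    ... | side q q′ | iΔ =
      commuteʳ (_ ∷ _ ∷ []) Γ∉𝒥 iΔ q (⊃-neg T g 𝒰 B C T∉𝒰)
        (cutʳ s c sh Γ∉𝒥 P R₁ (prepend-↭-++ (_ ∷ _ ∷ []) Ys q′) Ys≈)
    cutʳ s {Γ = Γ} c sh Γ∉𝒥 P {Ys = Ys} {Δ} R@(⊃-pos {Γ₁} {Γ₂} T g 𝒰 B C T∈𝒰 _ R₁ R₂) pr Ys≈
      with occurrence Ys pr Ys≈ | intuitionistic-beside Ys R pr
    ... | copy {Ys′} (lift T≐S′ , ≅A) Ys′≈ q′ | iΔ =
      reduce-⊃-pos ≅A s sh c T≐S′ T∈𝒰 P Γ∉𝒥 iΔ zs↭
        (cutʳ s c sh Γ∉𝒥 P R₁ (prepend-↭-++ (_ ∷ []) ys₁ xs₁↭) (All.++⁻ˡ ys₁ ys≈))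
        (cutʳ s c sh Γ∉𝒥 P R₂ (prepend-↭-++ (_ ∷ []) ys₂ xs₂↭) (All.++⁻ʳ ys₁ ys≈))
      where
        open ++-↭-++-Split (++-↭-++-split Γ₁ Ys′ q′)
        ys≈ = ↭.All-resp-↭ ys↭ Ys′≈
    ... | side q q′ | iΔ =
      exch (↭.++⁺ˡ Γ (↭-sym Δ↭))
        (contract* Γ _
          (⊢-via-↭ π Γ∉𝒥 (intuitionistic-++ Γ∉𝒥 (intuitionistic-resp-↭ Δ↭ iΔ))
            (λ i → ⊃-pos T g 𝒰 B C T∈𝒰 i
              (⊢-to-front Γ (cutʳ s c sh Γ∉𝒥 P R₁ (prepend-↭-++ (_ ∷ []) ys₁ xs₁↭) (All.++⁻ˡ ys₁ ys≈)))
              (⊢-to-front Γ (cutʳ s c sh Γ∉𝒥 P R₂ (prepend-↭-++ (_ ∷ []) ys₂ xs₂↭) (All.++⁻ʳ ys₁ ys≈))))))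
      where
        open ++-↭-++-Split (++-↭-++-split Γ₁ Ys q′)
        H = T ⟪ B ⊃[ g , 𝒰 ] C ⟫
        ys≈ = ↭.All-resp-↭ ys↭ Ys≈
        Δ↭ : Δ ↭ H ∷ zs₁ ++ zs₂
        Δ↭ = ↭-trans q (prep H zs↭)
        π : H ∷ (Γ ++ zs₁) ++ Γ ++ zs₂ ↭ Γ ++ Γ ++ H ∷ zs₁ ++ zs₂
        π = solve 4 (λ h γ δ₁ δ₂ → h ⊕ (γ ⊕ δ₁) ⊕ γ ⊕ δ₂ ⊜ γ ⊕ γ ⊕ h ⊕ δ₁ ⊕ δ₂) ↭-refl (H ∷ []) Γ zs₁ zs₂

    cutʳ-under-∀ : ∀ s {S S′ A Γ} → Complementary S S′ → HasShape A s → 𝒥-Free Γ → Principal S A Γ →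
                   ∀ {Y Θ Ys Δ} → ⊢ Y ∷ shiftΓ Θ → Θ ↭ Ys ++ Δ → Copies S′ A Ys → ⊢ Y ∷ shiftΓ (Γ ++ Δ)
    cutʳ-under-∀ s {Γ = Γ} c sh Γ∉𝒥 P {Θ = Θ} {Ys} {Δ} R q Ys≈ =
      ⊢-unshift Γ Δ
        (cutʳ s c (HasShape-subF σ↑ sh) (All.map⁺ Γ∉𝒥) (Principal-subst σ↑ P) R
          (↭-trans (↭-reflexive (cong (_ ∷_) (shiftΓ-subΓ Θ)))
                   (prepend-↭-++ (_ ∷ []) _ (↭-subΓ-++ σ↑ Ys q)))
          (copies-subΓ σ↑ Ys≈))

    reduce-¬ : ∀ {S S′ A Γ Δ T g B} → ¬[ g ] B ≅ A → ∀ s → HasShape A s → Complementary S S′ →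
               T ≐ S′ → Principal S A Γ → ⊢ Γ ++ preimage g T ⟪ B ⟫ ∷ Δ → ⊢ Γ ++ Δ
    reduce-¬ {Γ = Γ} {Δ} (¬≅ g≗f B≅A′) (¬ₛ s) (¬ʰ sh) c T≐S′ (by¬ d) d′ =
      contract* Γ Δ (cut s (complementary-preimage c T≐S′ g≗f) sh B≅A′ d (⊢-to-front Γ d′))

    reduce-∧-neg-l : ∀ {S S′ A Γ Δ T 𝒰 B C} → B ∧[ 𝒰 ] C ≅ A → ∀ s → HasShape A s →
                     Complementary S S′ → T ≐ S′ → T ∉ 𝒰 → Principal S A Γ →
                     ⊢ Γ ++ T ⟪ B ⟫ ∷ Δ → ⊢ Γ ++ Δ
    reduce-∧-neg-l {Γ = Γ} {Δ} (∧≅ B≅A₁ _ _) (s ∧ₛ _) (∧ʰ sh _) c T≐S′ _ (by∧-pos _ d _) d′ =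
      contract* Γ Δ (cut s (complementary-≐ʳ c T≐S′) sh B≅A₁ d (⊢-to-front Γ d′))
    reduce-∧-neg-l (∧≅ _ u _) _ _ c T≐S′ T∉𝒰 (by∧-neg-l S∉𝒰 _) _ = ⊥-elim (¬both-∉ c T≐S′ u T∉𝒰 S∉𝒰)
    reduce-∧-neg-l (∧≅ _ u _) _ _ c T≐S′ T∉𝒰 (by∧-neg-r S∉𝒰 _) _ = ⊥-elim (¬both-∉ c T≐S′ u T∉𝒰 S∉𝒰)

    reduce-∧-neg-r : ∀ {S S′ A Γ Δ T 𝒰 B C} → B ∧[ 𝒰 ] C ≅ A → ∀ s → HasShape A s →
                     Complementary S S′ → T ≐ S′ → T ∉ 𝒰 → Principal S A Γ →
                     ⊢ Γ ++ T ⟪ C ⟫ ∷ Δ → ⊢ Γ ++ Δ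
    reduce-∧-neg-r {Γ = Γ} {Δ} (∧≅ _ _ C≅A₂) (_ ∧ₛ s) (∧ʰ _ sh) c T≐S′ _ (by∧-pos _ _ d) d′ =
      contract* Γ Δ (cut s (complementary-≐ʳ c T≐S′) sh C≅A₂ d (⊢-to-front Γ d′))
    reduce-∧-neg-r (∧≅ _ u _) _ _ c T≐S′ T∉𝒰 (by∧-neg-l S∉𝒰 _) _ = ⊥-elim (¬both-∉ c T≐S′ u T∉𝒰 S∉𝒰)
    reduce-∧-neg-r (∧≅ _ u _) _ _ c T≐S′ T∉𝒰 (by∧-neg-r S∉𝒰 _) _ = ⊥-elim (¬both-∉ c T≐S′ u T∉𝒰 S∉𝒰)

    reduce-∧-pos : ∀ {S S′ A Γ Δ T 𝒰 B C} → B ∧[ 𝒰 ] C ≅ A → ∀ s → HasShape A s →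
                   Complementary S S′ → T ≐ S′ → T ∈ 𝒰 → Principal S A Γ →
                   ⊢ Γ ++ T ⟪ B ⟫ ∷ Δ → ⊢ Γ ++ T ⟪ C ⟫ ∷ Δ → ⊢ Γ ++ Δ
    reduce-∧-pos {Γ = Γ} {Δ} (∧≅ B≅A₁ _ _) (s ∧ₛ _) (∧ʰ sh _) c T≐S′ _ (by∧-pos _ d _) d′ _ =
      contract* Γ Δ (cut s (complementary-≐ʳ c T≐S′) sh B≅A₁ d (⊢-to-front Γ d′))
    reduce-∧-pos {Γ = Γ} {Δ} (∧≅ B≅A₁ _ _) (s ∧ₛ _) (∧ʰ sh _) c T≐S′ _ (by∧-neg-l _ d) d′ _ =
      contract* Γ Δ (cut s (complementary-≐ʳ c T≐S′) sh B≅A₁ d (⊢-to-front Γ d′))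
    reduce-∧-pos {Γ = Γ} {Δ} (∧≅ _ _ C≅A₂) (_ ∧ₛ s) (∧ʰ _ sh) c T≐S′ _ (by∧-neg-r _ d) _ d′ =
      contract* Γ Δ (cut s (complementary-≐ʳ c T≐S′) sh C≅A₂ d (⊢-to-front Γ d′))

    reduce-∀-neg : ∀ {S S′ A Γ Δ T 𝒰 B t} → ∀[ 𝒰 ] B ≅ A → ∀ s → HasShape A s →
                   Complementary S S′ → T ≐ S′ → T ∉ 𝒰 → Principal S A Γ →
                   ⊢ Γ ++ T ⟪ B [ t ] ⟫ ∷ Δ → ⊢ Γ ++ Δ
    reduce-∀-neg {Γ = Γ} {Δ} {t = t} (∀≅ _ B≅A′) (∀ₛ s) (∀ʰ sh) c T≐S′ _ (by∀-pos _ d) d′ =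
      contract* Γ Δ (cut s (complementary-≐ʳ c T≐S′) (HasShape-subF (inst t) sh) (≅-subF (inst t) B≅A′)
                         (⊢-[] t d) (⊢-to-front Γ d′))
    reduce-∀-neg (∀≅ u _) _ _ c T≐S′ T∉𝒰 (by∀-neg S∉𝒰 _ _) _ = ⊥-elim (¬both-∉ c T≐S′ u T∉𝒰 S∉𝒰)

    reduce-∀-pos : ∀ {S S′ A Γ Δ T 𝒰 B} → ∀[ 𝒰 ] B ≅ A → ∀ s → HasShape A s →
                   Complementary S S′ → T ≐ S′ → T ∈ 𝒰 → Principal S A Γ →
                   ⊢ T ⟪ B ⟫ ∷ shiftΓ (Γ ++ Δ) → ⊢ Γ ++ Δ
    reduce-∀-pos {Γ = Γ} {Δ} (∀≅ _ B≅A′) (∀ₛ s) (∀ʰ sh) c T≐S′ _ (by∀-neg _ t d) d′ =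
      contract* Γ Δ (cut s (complementary-≐ʳ c T≐S′) (HasShape-subF (inst t) sh) (≅-subF (inst t) B≅A′)
                         d (⊢-[] t d′))
    reduce-∀-pos {Γ = Γ} {Δ} (∀≅ _ B≅A′) (∀ₛ s) (∀ʰ sh) c T≐S′ _ (by∀-pos _ d) d′ =
      contract* Γ Δ (cut s (complementary-≐ʳ c T≐S′) (HasShape-subF (inst x) sh) (≅-subF (inst x) B≅A′)
                         (⊢-[] x d) (⊢-[] x d′))
      where x = var 0

    reduce-⊃-neg : ∀ {S S′ A Γ Δ T g 𝒰 B C} → B ⊃[ g , 𝒰 ] C ≅ A → ∀ s → HasShape A s →
                   Complementary S S′ → T ≐ S′ → T ∉ 𝒰 → Principal S A Γ →
                   ⊢ Γ ++ preimage g T ⟪ B ⟫ ∷ T ⟪ C ⟫ ∷ Δ → ⊢ Γ ++ Δ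
    reduce-⊃-neg {Δ = Δ} {T} {g} {B = B} {C} (⊃≅ B≅A₁ g≗f _ C≅A₂) (s₁ ⊃ₛ s₂) (⊃ʰ sh₁ sh₂) c T≐S′ _
                 (by⊃-pos {Γ₁ = Γ₁} {Γ₂} _ d₁ d₂) d′ =
      contract* Γ Δ (subst ⊢_ (sym (List.++-assoc Γ₁ Γ₂ (Γ ++ Δ)))
        (cut s₁ (complementary-preimage c T≐S′ g≗f) sh₁ B≅A₁ d₁
          (exch (solve 4 (λ γ₂ γ p δ → γ₂ ⊕ γ ⊕ p ⊕ δ ⊜ p ⊕ γ₂ ⊕ γ ⊕ δ) ↭-refl Γ₂ Γ (P ∷ []) Δ)
            (cut s₂ (complementary-≐ʳ c T≐S′) sh₂ C≅A₂ d₂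
              (exch (solve 4 (λ γ p q δ → γ ⊕ p ⊕ q ⊕ δ ⊜ q ⊕ γ ⊕ p ⊕ δ) ↭-refl Γ (P ∷ []) (Q ∷ []) Δ)
                    d′)))))
      where
        Γ = Γ₁ ++ Γ₂
        P = preimage g T ⟪ B ⟫
        Q = T ⟪ C ⟫
    reduce-⊃-neg (⊃≅ _ _ u _) _ _ c T≐S′ T∉𝒰 (by⊃-neg S∉𝒰 _) _ = ⊥-elim (¬both-∉ c T≐S′ u T∉𝒰 S∉𝒰)

    reduce-⊃-pos : ∀ {S S′ A Γ Δ Δ₁ Δ₂ T g 𝒰 B C} → B ⊃[ g , 𝒰 ] C ≅ A → ∀ s → HasShape A s →
                   Complementary S S′ → T ≐ S′ → T ∈ 𝒰 → Principal S A Γ → 𝒥-Free Γ →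
                   Intuitionistic Δ → Δ ↭ Δ₁ ++ Δ₂ →
                   ⊢ Γ ++ preimage g T ⟪ B ⟫ ∷ Δ₁ → ⊢ Γ ++ T ⟪ C ⟫ ∷ Δ₂ → ⊢ Γ ++ Δ
    reduce-⊃-pos {Γ = Γ} {Δ} {Δ₁} {Δ₂} (⊃≅ B≅A₁ g≗f _ C≅A₂) (s₁ ⊃ₛ s₂) (⊃ʰ sh₁ sh₂) c T≐S′ _
                 (by⊃-neg _ d) _ _ Δ↭ d₁′ d₂′ =
      exch (↭.++⁺ˡ Γ (↭-sym Δ↭)) (contract* Γ (Δ₁ ++ Δ₂) (contract* Γ (Γ ++ Δ₁ ++ Δ₂)
        (exch (solve 3 (λ γ δ₁ δ₂ → (γ ⊕ γ ⊕ δ₂) ⊕ γ ⊕ δ₁ ⊜ γ ⊕ γ ⊕ γ ⊕ δ₁ ⊕ δ₂) ↭-refl Γ Δ₁ Δ₂)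
          (cut s₁ (complementary-preimage c T≐S′ g≗f) sh₁ B≅A₁
            (cut s₂ (complementary-≐ʳ c T≐S′) sh₂ C≅A₂ (exch (swap _ _ ↭-refl) d) (⊢-to-front Γ d₂′))
            (⊢-to-front Γ d₁′)))))
    reduce-⊃-pos {Δ = Δ} {Δ₁} {Δ₂} (⊃≅ B≅A₁ g≗f _ _) (s₁ ⊃ₛ _) (⊃ʰ sh₁ _) c T≐S′ _
                 (by⊃-pos {Γ₁ = Γ₁} {Γ₂} _ d₁ _) Γ∉𝒥 iΔ Δ↭ d₁′ _ =
      exch (↭.++⁺ˡ Γ (↭-sym Δ↭)) (contract* Γ (Δ₁ ++ Δ₂)
        (⊢-via-↭ π Γ∉𝒥 (intuitionistic-++ Γ∉𝒥 (intuitionistic-resp-↭ Δ↭ iΔ))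
          (λ i → weaken* (Γ₂ ++ Δ₂) i
            (cut s₁ (complementary-preimage c T≐S′ g≗f) sh₁ B≅A₁ d₁ (⊢-to-front Γ d₁′)))))
      where
        Γ = Γ₁ ++ Γ₂
        π : (Γ₂ ++ Δ₂) ++ Γ₁ ++ Γ ++ Δ₁ ↭ Γ ++ Γ ++ Δ₁ ++ Δ₂
        π = solve 4 (λ γ₁ γ₂ δ₁ δ₂ → (γ₂ ⊕ δ₂) ⊕ γ₁ ⊕ (γ₁ ⊕ γ₂) ⊕ δ₁ ⊜ (γ₁ ⊕ γ₂) ⊕ (γ₁ ⊕ γ₂) ⊕ δ₁ ⊕ δ₂)
                    ↭-refl Γ₁ Γ₂ Δ₁ Δ₂

  cut-admissible : ∀ {T T′ C Γ₁ Γ₂} → Complementary T T′ →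
                   ⊢ T ⟪ C ⟫ ∷ Γ₁ → ⊢ T′ ⟪ C ⟫ ∷ Γ₂ → ⊢ Γ₁ ++ Γ₂
  cut-admissible {C = C} c = cut (shape C) c (hasShape C) ≅-refl

module Inversion (Ω Fun Pred : Set) (𝒥 : Ultrafilter Ω) where
  open MRLJ Ω Fun Pred hiding (⊢_; Intuitionistic)
  open Formulas Ω Fun Pred
  open Derivations Ω Fun Pred 𝒥

  -- The axiom with no role sets partitions Ω only if Ω is empty.
  ⊬[] : ∀ {Θ} → ⊢ Θ → Θ ↭ [] → ¬ Ω
  ⊬[] (exch q d) p = ⊬[] d (↭-trans q p)
  ⊬[] (ext w d) p with Pointwise-↭ (≈I⇒≋ w) p
  ... | _ , q , [] = ⊬[] d q
  ⊬[] (Id _ _ [] partition _) _ r with proj₁ partition r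
  ... | () , _
  ⊬[] (Id _ _ (_ ∷ _) _ _) p _ = ↭.¬x∷xs↭[] p
  ⊬[] (Weaken _ _ _ _) p _ = ↭.¬x∷xs↭[] p
  ⊬[] (Contract _ _ _ _) p _ = ↭.¬x∷xs↭[] p
  ⊬[] (Neg _ _ _ _ _) p _ = ↭.¬x∷xs↭[] p
  ⊬[] (∧-neg-l _ _ _ _ _ _ _) p _ = ↭.¬x∷xs↭[] p
  ⊬[] (∧-neg-r _ _ _ _ _ _ _) p _ = ↭.¬x∷xs↭[] p
  ⊬[] (∧-pos _ _ _ _ _ _ _ _) p _ = ↭.¬x∷xs↭[] p
  ⊬[] (∀-neg _ _ _ _ _ _ _) p _ = ↭.¬x∷xs↭[] p
  ⊬[] (∀-pos _ _ _ _ _ _) p _ = ↭.¬x∷xs↭[] p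
  ⊬[] (⊃-neg _ _ _ _ _ _ _ _) p _ = ↭.¬x∷xs↭[] p
  ⊬[] (⊃-pos _ _ _ _ _ _ _ _ _) p _ = ↭.¬x∷xs↭[] p

  ⊃-neg-inversion : ∀ {Θ X R f 𝒰 A B} → ⊢ Θ → Θ ↭ X ∷ [] → X ≈ᵢ R ⟪ A ⊃[ f , 𝒰 ] B ⟫ →
                    R ∈ 𝒥 → R ∉ 𝒰 → ⊢ preimage f R ⟪ A ⟫ ∷ R ⟪ B ⟫ ∷ []
  ⊃-neg-inversion (exch q d) p X≈ = ⊃-neg-inversion d (↭-trans q p) X≈
  ⊃-neg-inversion (ext w d) p X≈ with Pointwise-↭ (≈I⇒≋ w) p
  ... | _ , q , (X′≈X ∷ []) = ⊃-neg-inversion d q (≈ᵢ-trans X′≈X X≈)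
  ⊃-neg-inversion (Id p ts Rs _ _) pe (_ , atom≅⊃) _ _
    with subst (_≅ _) (All.head (↭.All-resp-↭ pe (atoms-map p ts Rs))) atom≅⊃
  ... | ()
  ⊃-neg-inversion {𝒰 = 𝒰} (Weaken _ _ _ d) p _ _ R∉𝒰 with ↭.↭-singleton-inv p
  ... | refl =
    ⊥-elim (R∉𝒰 (Ultrafilter.upward 𝒰 (Ultrafilter.full∈ 𝒰) (λ r _ → ⊥-elim (⊬[] d ↭-refl r))))
  ⊃-neg-inversion (Contract _ _ _ d) p X≈ R∈𝒥 _ with ↭.↭-singleton-inv p
  ... | refl = ⊥-elim (⊬𝒥-twice (role-∈-𝒥 X≈ R∈𝒥) d)
  ⊃-neg-inversion (Neg _ _ _ _ _) p X≈ _ _ with ↭.↭-singleton-inv p | X≈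
  ... | refl | _ , ()
  ⊃-neg-inversion (∧-neg-l _ _ _ _ _ _ _) p X≈ _ _ with ↭.↭-singleton-inv p | X≈
  ... | refl | _ , ()
  ⊃-neg-inversion (∧-neg-r _ _ _ _ _ _ _) p X≈ _ _ with ↭.↭-singleton-inv p | X≈
  ... | refl | _ , ()
  ⊃-neg-inversion (∧-pos _ _ _ _ _ _ _ _) p X≈ _ _ with ↭.↭-singleton-inv p | X≈
  ... | refl | _ , ()
  ⊃-neg-inversion (∀-neg _ _ _ _ _ _ _) p X≈ _ _ with ↭.↭-singleton-inv p | X≈
  ... | refl | _ , ()
  ⊃-neg-inversion (∀-pos _ _ _ _ _ _) p X≈ _ _ with ↭.↭-singleton-inv p | X≈
  ... | refl | _ , ()
  ⊃-neg-inversion (⊃-pos _ _ _ _ _ T∈𝒰′ _ _ _) p X≈ _ R∉𝒰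
    with List.∷-injectiveˡ (↭.↭-singleton-inv p) | X≈
  ... | refl | lift T≐R , ⊃≅ _ _ 𝒰′≈𝒰 _ = ⊥-elim (R∉𝒰 (∈-resp-≈ᵤ 𝒰′≈𝒰 T≐R T∈𝒰′))
  ⊃-neg-inversion (⊃-neg _ _ _ _ _ _ _ d) p X≈ _ _ with ↭.↭-singleton-inv p | X≈
  ... | refl | lift T≐R , ⊃≅ C≅A g≗f _ D≅B =
    ⊢-resp-≋ ((lift (preimage-cong g≗f T≐R) , C≅A) ∷ (lift T≐R , D≅B) ∷ []) d

proposition7 : (Ω Fun Pred : Set) (𝒥 : Ultrafilter Ω)
    (f : Ω → Ω) (𝒰 : Ultrafilter Ω)
    (A B : MRLJ.Formula Ω Fun Pred) (R : RoleSet Ω) →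
    R ∈ 𝒥 → R ∉ 𝒰 → preimage f R ≐ ∁ R →
    MRLJ.⊢_ Ω Fun Pred 𝒥 (MRLJ._⟪_⟫ R (MRLJ._⊃[_,_]_ A f 𝒰 B) ∷ []) →
    (Γ : MRLJ.Sequent Ω Fun Pred) →
    MRLJ.⊢_ Ω Fun Pred 𝒥 (MRLJ._⟪_⟫ R A ∷ Γ) →
    MRLJ.⊢_ Ω Fun Pred 𝒥 (MRLJ._⟪_⟫ R B ∷ Γ)
proposition7 Ω Fun Pred 𝒥 f 𝒰 A B R R∈𝒥 R∉𝒰 f⁻¹R≐∁R ⊢A⊃B Γ ⊢A,Γ =
  exch (↭.++-comm Γ (R ⟪ B ⟫ ∷ [])) (cut-admissible R∁f⁻¹R ⊢A,Γ ⊢f⁻¹A,B)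
  where
    open MRLJ Ω Fun Pred using (_⟪_⟫; exch)
    open Derivations Ω Fun Pred 𝒥 using (≈ᵢ-refl)
    open CutAdmissibility Ω Fun Pred 𝒥 using (cut-admissible)
    open Inversion Ω Fun Pred 𝒥 using (⊃-neg-inversion)

    R∁f⁻¹R : Complementary R (preimage f R)
    R∁f⁻¹R = complementary-resp-≐ ≐-refl (≐-sym f⁻¹R≐∁R) (∁-complementary R)

    ⊢f⁻¹A,B : MRLJ.⊢_ Ω Fun Pred 𝒥 (preimage f R ⟪ A ⟫ ∷ R ⟪ B ⟫ ∷ [])
    ⊢f⁻¹A,B = ⊃-neg-inversion ⊢A⊃B ↭-refl ≈ᵢ-refl R∈𝒥 R∉𝒰
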